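{- Let $\mathcal{H}\subset\mathcal{O}$ be a family with $\mathfrak{h}_2\in\mathcal{H}$, let $\mathfrak{g}_0,\mathfrak{g}_1,\dots$ be a fixed enumeration of the elements of $\bar{\mathcal{H}}$ with $|V_s(\mathfrak{g}_0)|\le|V_s(\mathfrak{g}_1)|\le\cdots$, and for $m\ge0$ let $\mathcal{H}(m)=\{\mathfrak{g}_i:0\le i\le\min\{m,|\bar{\mathcal{H}}|-1\}\}$. Let $G$ be a slim $\mathcal{H}$-line graph. Then the following are equivalent: (1) $G$ has a unique strict $\bar{\mathcal{H}}$-cover up to equivalence; (2) for every $m\in\mathbb{N}\cup\{0\}$, if $G$ is a slim $\mathcal{H}(m)$-line graph, then $G$ has a unique strict $\mathcal{H}(m)$-cover up to equivalence.
   Context: A Hoffman graph $\mathfrak{h}=(H,\mu)$ is a finite simple graph $H$ with labeling $\mu:V(H)\to\{f,s\}$ such that every fat vertex (label $f$) has a slim neighbour (label $s$), and fat vertices are pairwise non-adjacent. $V_s,V_f$ denote slim/fat vertex sets, $N^f_{\mathfrak{h}}(x)$ fat neighbours of $x$. A Hoffman subgraph is an induced subgraph with restricted labeling; isomorphisms preserve labels; families and membership are up to isomorphism. Ordinary graphs are Hoffman graphs with no fat vertices. Sum: $\mathfrak{h}=\bigoplus_i\mathfrak{h}^i$ (Hoffman subgraphs) means (i) $V(\mathfrak{h})=\bigcup V(\mathfrak{h}^i)$; (ii) $V_s(\mathfrak{h})$ is the disjoint union of the $V_s(\mathfrak{h}^i)$; (iii) $N^f_{\mathfrak{h}^i}(x)=N^f_{\mathfrak{h}}(x)$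 for $x\in V_s(\mathfrak{h}^i)$; (iv) for slim $x\in\mathfrak{h}^i$, $y\in\mathfrak{h}^j$, $i\ne j$: $|N^f_{\mathfrak{h}}(x)\cap N^f_{\mathfrak{h}}(y)|\le1$ with equality iff $x,y$ adjacent. Indecomposable: not a sum of two non-empty Hoffman subgraphs. Fat: every slim vertex has a fat neighbour. $\mathfrak{h}_2$: one slim vertex adjacent to two fat vertices. $\mathcal{O}$: $\mathfrak{h}_2$ together with all indecomposable fat Hoffman graphs with at least two slim vertices and exactly one fat vertex. $\bar{\mathcal{H}}=\{\mathfrak{h}_2\}\cup\{\mathfrak{h}\in\mathcal{O}:\mathfrak{h}$ is a Hoffman subgraph of an element of $\mathcal{H}\}$. For a family $\mathcal{F}$, $\mathfrak{g}$ is an $\mathcal{F}$-line Hoffman graph if it is a Hoffman subgraph of some sum $\mathfrak{h}$ of members of $\mathcal{F}$ (an $\mathcal{F}$-cover; strict if $V_s(\mathfrak{h})=V_s(\mathfrak{g})$); a slim $\mathcal{F}$-line graph is such a $\mathfrak{g}$ without fat vertices. Strict covers $\mathfrak{h},\mathfrak{h}'$ of $\mathfrak{g}$ are equivalent if some isomorphism $\mathfrak{h}\to\mathfrak{h}'$ restricts to the identity on $V(\mathfrak{g})$. -}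

module Defs where

open import Data.Nat using (ℕ; zero; suc; _+_; _≤_; _<_)
open import Data.Fin using (Fin; zero; suc)
open import Data.Bool using (Bool; true; false; _∧_; not; if_then_else_)
open import Data.Product using (Σ; ∃; ∃-syntax; _×_; _,_)
open import Data.Sum using (_⊎_)
open import Relation.Nullary using (¬_)
open import Relation.Binary.PropositionalEquality using (_≡_; _≢_; refl)

-- Hoffman graphs on vertex set Fin n.
-- adj is the (symmetric, irreflexive) adjacency relation of the simple
-- graph H; fat x ≡ true means μ(x) = f, fat x ≡ false means μ(x) = s.

record HoffmanGraph : Set where
  field
    n            : ℕ
    adj          : Fin n → Fin n → Bool
    fat          : Fin n → Bool
    adj-sym      : ∀ x y → adj x y ≡ adj y x
    adj-irrefl   : ∀ x → adj x x ≡ false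
    fat-indep    : ∀ x y → fat x ≡ true → fat y ≡ true → adj x y ≡ false
    fat-has-slim : ∀ x → fat x ≡ true → ∃[ y ] (adj x y ≡ true × fat y ≡ false)

open HoffmanGraph public

count : ∀ {n} → (Fin n → Bool) → ℕ
count {zero}  f = 0
count {suc n} f = (if f zero then 1 else 0) + count (λ x → f (suc x))

slimCount : HoffmanGraph → ℕ
slimCount h = count (λ x → not (fat h x))

fatCount : HoffmanGraph → ℕ
fatCount h = count (fat h)

commonFat : (h : HoffmanGraph) → Fin (n h) → Fin (n h) → ℕ
commonFat h x y = count (λ z → fat h z ∧ (adj h x z ∧ adj h y z))

-- g ↪ h : g is (isomorphic to) a Hoffman subgraph of h, i.e. an
-- injective map onto an induced subgraph preserving labels.

record _↪_ (g h : HoffmanGraph) : Set where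
  field
    fun       : Fin (n g) → Fin (n h)
    injective : ∀ x y → fun x ≡ fun y → x ≡ y
    adj-pres  : ∀ x y → adj h (fun x) (fun y) ≡ adj g x y
    fat-pres  : ∀ x → fat h (fun x) ≡ fat g x

open _↪_ public

record _≅_ (g h : HoffmanGraph) : Set where
  field
    emb        : g ↪ h
    surjective : ∀ y → ∃[ x ] (fun emb x ≡ y)

open _≅_ public

-- Families of Hoffman graphs (membership is up to isomorphism)

Family : Set₁
Family = HoffmanGraph → Set

_∈̂_ : HoffmanGraph → Family → Set
h ∈̂ F = ∃[ h' ] (F h' × h ≅ h')

-- Sums.  h = ⊕_{i<k} h^i, where the Hoffman subgraph h^i is given as the
-- image of the embedding emb i : part i ↪ h.

record IsSum (h : HoffmanGraph) {k : ℕ} (part : Fin k → HoffmanGraph)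
             (emb : ∀ i → part i ↪ h) : Set where
  field
    covers    : ∀ z → ∃[ i ] ∃[ x ] (fun (emb i) x ≡ z)
    -- (ii) slim vertex sets are disjoint (and their union is V_s(h) by (i))
    slim-disj : ∀ i j (x : Fin (n (part i))) (y : Fin (n (part j))) →
                fat (part i) x ≡ false →
                fun (emb i) x ≡ fun (emb j) y → i ≡ j
    -- (iii) N^f_{h^i}(x) = N^f_h(x) for slim x in h^i
    fat-nbrs  : ∀ i (x : Fin (n (part i))) (z : Fin (n h)) →
                fat (part i) x ≡ false → fat h z ≡ true →
                adj h (fun (emb i) x) z ≡ true →
                ∃[ y ] (fun (emb i) y ≡ z)
    -- (iv) slim x in h^i, y in h^j, i ≠ j
    common-le : ∀ i j (x : Fin (n (part i))) (y : Fin (n (part j))) → i ≢ j →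
                fat (part i) x ≡ false → fat (part j) y ≡ false →
                commonFat h (fun (emb i) x) (fun (emb j) y) ≤ 1
    common-eq : ∀ i j (x : Fin (n (part i))) (y : Fin (n (part j))) → i ≢ j →
                fat (part i) x ≡ false → fat (part j) y ≡ false →
                (commonFat h (fun (emb i) x) (fun (emb j) y) ≡ 1
                   → adj h (fun (emb i) x) (fun (emb j) y) ≡ true)
                × (adj h (fun (emb i) x) (fun (emb j) y) ≡ true
                   → commonFat h (fun (emb i) x) (fun (emb j) y) ≡ 1)

record FSum (F : Family) (h : HoffmanGraph) : Set where
  field
    k     : ℕ
    part  : Fin k → HoffmanGraph
    emb   : ∀ i → part i ↪ h
    inF   : ∀ i → part i ∈̂ F
    isSum : IsSum h part emb

Decomposable : HoffmanGraph → Set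
Decomposable h =
  ∃[ part ] ∃[ emb ] (IsSum h {2} part emb × (∀ i → 0 < n (part i)))

Indecomposable : HoffmanGraph → Set
Indecomposable h = ¬ Decomposable h

IsFat : HoffmanGraph → Set
IsFat h = ∀ x → fat h x ≡ false → ∃[ y ] (fat h y ≡ true × adj h x y ≡ true)

IsSlim : HoffmanGraph → Set
IsSlim h = ∀ x → fat h x ≡ false

-- 𝔥₂ : slim vertex 0 adjacent to fat vertices 1 and 2

private
  A3 : Fin 3 → Fin 3 → Bool
  A3 zero (suc zero) = true
  A3 zero (suc (suc zero)) = true
  A3 (suc zero) zero = true
  A3 (suc (suc zero)) zero = true
  A3 _ _ = false

  F3 : Fin 3 → Bool
  F3 zero = false
  F3 _ = true

  A3-sym : ∀ x y → A3 x y ≡ A3 y x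
  A3-sym zero zero = refl
  A3-sym zero (suc zero) = refl
  A3-sym zero (suc (suc zero)) = refl
  A3-sym (suc zero) zero = refl
  A3-sym (suc zero) (suc zero) = refl
  A3-sym (suc zero) (suc (suc zero)) = refl
  A3-sym (suc (suc zero)) zero = refl
  A3-sym (suc (suc zero)) (suc zero) = refl
  A3-sym (suc (suc zero)) (suc (suc zero)) = refl

  A3-irr : ∀ x → A3 x x ≡ false
  A3-irr zero = refl
  A3-irr (suc zero) = refl
  A3-irr (suc (suc zero)) = refl

  F3-indep : ∀ x y → F3 x ≡ true → F3 y ≡ true → A3 x y ≡ false
  F3-indep zero _ () _
  F3-indep (suc _) zero _ ()
  F3-indep (suc zero) (suc zero) _ _ = refl
  F3-indep (suc zero) (suc (suc zero)) _ _ = refl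
  F3-indep (suc (suc zero)) (suc zero) _ _ = refl
  F3-indep (suc (suc zero)) (suc (suc zero)) _ _ = refl

  F3-slim : ∀ x → F3 x ≡ true → ∃[ y ] (A3 x y ≡ true × F3 y ≡ false)
  F3-slim zero ()
  F3-slim (suc zero) _ = zero , refl , refl
  F3-slim (suc (suc zero)) _ = zero , refl , refl

𝔥₂ : HoffmanGraph
𝔥₂ = record
  { n = 3 ; adj = A3 ; fat = F3
  ; adj-sym = A3-sym ; adj-irrefl = A3-irr
  ; fat-indep = F3-indep ; fat-has-slim = F3-slim }

𝒪 : Family
𝒪 h = (h ≅ 𝔥₂)
    ⊎ (Indecomposable h × IsFat h × 2 ≤ slimCount h × fatCount h ≡ 1)

Hbar : Family → Family
Hbar H h = (h ≅ 𝔥₂) ⊎ (𝒪 h × ∃[ h' ] (H h' × h ↪ h'))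

-- Fixed enumeration g₀, g₁, … of the elements (iso classes) of a family.
-- Valid i means i < |F| (Valid is downward closed; if F is infinite every
-- i is valid).

record Enumeration (F : Family) : Set₁ where
  field
    g          : ℕ → HoffmanGraph
    Valid      : ℕ → Set
    valid-down : ∀ i j → i ≤ j → Valid j → Valid i
    sound      : ∀ i → Valid i → g i ∈̂ F
    complete   : ∀ h → h ∈̂ F → ∃[ i ] (Valid i × h ≅ g i)
    distinct   : ∀ i j → Valid i → Valid j → g i ≅ g j → i ≡ j
    monotone   : ∀ i j → Valid i → Valid j → i ≤ j →
                 slimCount (g i) ≤ slimCount (g j)

truncate : ∀ {F} → Enumeration F → ℕ → Family
truncate E m h = ∃[ i ] (i ≤ m × Enumeration.Valid E i × h ≅ Enumeration.g E i)

record Cover (F : Family) (G : HoffmanGraph) : Set where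
  field
    host  : HoffmanGraph
    sum   : FSum F host
    embed : G ↪ host

open Cover public

IsLineGraph : Family → HoffmanGraph → Set
IsLineGraph F G = Cover F G

record StrictCover (F : Family) (G : HoffmanGraph) : Set where
  field
    cover  : Cover F G
    strict : ∀ z → fat (host cover) z ≡ false → ∃[ x ] (fun (embed cover) x ≡ z)

open StrictCover public

Equivalent : ∀ {F G} → StrictCover F G → StrictCover F G → Set
Equivalent c c' =
  ∃[ φ ] ((∀ x → fun (emb {host (cover c)} {host (cover c')} φ)
                       (fun (embed (cover c)) x)
                  ≡ fun (embed (cover c')) x))

UniqueStrictCover : Family → HoffmanGraph → Set
UniqueStrictCover F G =
  StrictCover F G × (∀ (c c' : StrictCover F G) → Equivalent c c')

module Submission where

-- Uniqueness transfers in both directions because ℋ(m) ⊆ H̄ and because a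
-- cover uses finitely many parts, so every H̄-cover is an ℋ(M)-cover for M
-- the largest index of its parts (module Truncation).  The remaining content
-- of (1) ⇒ (2) is existence: every slim ℋ(m)-line graph G has a strict
-- ℋ(m)-cover.  Given any cover with host D, call two vertices of G linked if
-- they are distinct, non-adjacent and share a fat neighbour in D.  Linked
-- vertices lie in one part, which has a single fat vertex (CoverAnalysis).
-- The strict host (StrictHost) consists of G, the fat neighbours in D of G,
-- and a fresh fat vertex for each unlinked vertex of a single-fat part; its
-- parts are the linking components with their fat neighbours.  A singleton
-- component gives a copy of 𝔥₂, whose index is 0.  A larger component gives a
-- fat-link connected, hence indecomposable, Hoffman subgraph of an original
-- part with the same single fat vertex, so it lies in H̄ and precedes that
-- part in the enumeration (truncate-↪-closed).

open import Defs
open import Data.Nat using (ℕ; zero; suc; _+_; _≤_; _<_; z≤n; s≤s; _⊔_)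
open import Data.Nat.Properties
  using (≤-refl; ≤-trans; ≤-antisym; ≤-total; ≤-reflexive; +-comm; +-assoc; +-suc; +-mono-≤;
         +-identityʳ; +-commutativeSemigroup; m≤n+m; n≤1+n; n≮n; <-irrefl; <-≤-trans; m≤n⇒m<n∨m≡n; m≤m⊔n; m≤n⊔m; m≤n⇒∃[o]m+o≡n)
open import Algebra.Properties.CommutativeSemigroup +-commutativeSemigroup using (x∙yz≈y∙xz)
open import Data.Fin using (Fin; zero; suc; toℕ; fromℕ<; _≟_; punchIn; punchOut; _↑ˡ_; _↑ʳ_; splitAt; join)
open import Data.Fin.Properties
  using (suc-injective; punchIn-punchOut; punchOut-injective; toℕ-injective; splitAt-↑ˡ; splitAt-↑ʳ; join-splitAt)
open import Data.Bool using (Bool; true; false; _∧_; _∨_; not; if_then_else_)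
open import Data.Bool.Properties using (∧-conicalˡ; ∧-conicalʳ; ∧-comm; ∧-zeroʳ; not-¬; ¬-not; not-injective)
open import Data.Product using (∃-syntax; _×_; _,_; proj₁; proj₂)
open import Data.Sum using (_⊎_; inj₁; inj₂)
open import Data.Empty using (⊥; ⊥-elim)
open import Relation.Nullary using (does; yes; no)
open import Relation.Nullary.Decidable using (dec-true; dec-false; does-⇔)
open import Function.Bundles using (mk⇔)
open import Relation.Binary.PropositionalEquality
  using (_≡_; _≢_; refl; sym; trans; cong; cong₂; subst; subst₂; module ≡-Reasoning)

contradictory : ∀ {a} → a ≡ true → a ≡ false → ⊥
contradictory = not-¬

∧-trueˡ : ∀ {a b} → a ∧ b ≡ true → a ≡ true
∧-trueˡ = ∧-conicalˡ _ _

∧-trueʳ : ∀ {a b} → a ∧ b ≡ true → b ≡ true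
∧-trueʳ = ∧-conicalʳ _ _

∧-true : ∀ {a b} → a ≡ true → b ≡ true → a ∧ b ≡ true
∧-true refl refl = refl

∨-trueˡ : ∀ {a b} → a ≡ true → a ∨ b ≡ true
∨-trueˡ refl = refl

∨-trueʳ : ∀ {a b} → b ≡ true → a ∨ b ≡ true
∨-trueʳ {true}  _ = refl
∨-trueʳ {false} p = p

∨-true-cases : ∀ {a b} → a ∨ b ≡ true → (a ≡ true) ⊎ (b ≡ true)
∨-true-cases {true}  _ = inj₁ refl
∨-true-cases {false} p = inj₂ p

∧-absorbˡ : ∀ a b → (b ≡ true → a ≡ true) → a ∧ b ≡ b
∧-absorbˡ true  b     _ = refl
∧-absorbˡ false false _ = refl
∧-absorbˡ false true  h with h refl
... | ()

_==_ : ∀ {n} → Fin n → Fin n → Bool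
x == y = does (x ≟ y)

==-sound : ∀ {n} (x y : Fin n) → x == y ≡ true → x ≡ y
==-sound x y p with x ≟ y
... | yes e = e

==-refl : ∀ {n} (x : Fin n) → x == x ≡ true
==-refl x = dec-true (x ≟ x) refl

==-false : ∀ {n} {x y : Fin n} → x ≢ y → x == y ≡ false
==-false {x = x} {y} = dec-false (x ≟ y)

==-sym : ∀ {n} (x y : Fin n) → x == y ≡ y == x
==-sym x y = does-⇔ (mk⇔ sym sym) (x ≟ y) (y ≟ x)

anyFin : ∀ {n} → (Fin n → Bool) → Bool
anyFin {zero}  f = false
anyFin {suc n} f = f zero ∨ anyFin (λ x → f (suc x))

anyFin-intro : ∀ {n} (f : Fin n → Bool) a → f a ≡ true → anyFin f ≡ true
anyFin-intro f zero    p = ∨-trueˡ p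
anyFin-intro f (suc a) p = ∨-trueʳ {f zero} (anyFin-intro (λ x → f (suc x)) a p)

anyFin-witness : ∀ {n} (f : Fin n → Bool) → anyFin f ≡ true → ∃[ a ] (f a ≡ true)
anyFin-witness {suc n} f p with ∨-true-cases {f zero} p
... | inj₁ q = zero , q
... | inj₂ q with anyFin-witness (λ x → f (suc x)) q
... | a , r = suc a , r

anyFin-false : ∀ {n} (f : Fin n → Bool) → anyFin f ≡ false → ∀ a → f a ≡ false
anyFin-false f p a = ¬-not (λ q → contradictory (anyFin-intro f a q) p)

anyFin-ext : ∀ {n} (f g : Fin n → Bool) → (∀ x → f x ≡ g x) → anyFin f ≡ anyFin g
anyFin-ext {zero}  f g e = refl
anyFin-ext {suc n} f g e =
  cong₂ _∨_ (e zero) (anyFin-ext (λ x → f (suc x)) (λ x → g (suc x)) (λ x → e (suc x)))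

anyFin-mono : ∀ {n} (f g : Fin n → Bool) → (∀ x → f x ≡ true → g x ≡ true) →
              anyFin f ≡ true → anyFin g ≡ true
anyFin-mono f g h p = let (a , q) = anyFin-witness f p in anyFin-intro g a (h a q)

least : ∀ {n} (f : Fin n → Bool) a → f a ≡ true →
        ∃[ b ] (f b ≡ true × ∀ c → f c ≡ true → toℕ b ≤ toℕ c)
least {suc n} f a p with f zero in eq
... | true = zero , eq , λ _ _ → z≤n
least {suc n} f zero    p | false = ⊥-elim (contradictory p eq)
least {suc n} f (suc a) p | false =
  let (b , q , r) = least (λ x → f (suc x)) a p in
  suc b , q , λ { zero s → ⊥-elim (contradictory s eq) ; (suc c) s → s≤s (r c s) }

bit : Bool → ℕ
bit b = if b then 1 else 0

bit-mono : ∀ {a b} → (a ≡ true → b ≡ true) → bit a ≤ bit b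
bit-mono {false} _ = z≤n
bit-mono {true}  p rewrite p refl = ≤-refl

count-ext : ∀ {n} (f g : Fin n → Bool) → (∀ x → f x ≡ g x) → count f ≡ count g
count-ext {zero}  f g e = refl
count-ext {suc n} f g e rewrite e zero =
  cong (bit (g zero) +_) (count-ext (λ x → f (suc x)) (λ x → g (suc x)) (λ x → e (suc x)))

count-mono : ∀ {n} (f g : Fin n → Bool) → (∀ x → f x ≡ true → g x ≡ true) → count f ≤ count g
count-mono {zero}  f g e = z≤n
count-mono {suc n} f g e =
  +-mono-≤ (bit-mono (e zero)) (count-mono (λ x → f (suc x)) (λ x → g (suc x)) (λ x → e (suc x)))

count-strict : ∀ {n} (f g : Fin n → Bool) → (∀ x → f x ≡ true → g x ≡ true) →
               ∀ a → f a ≡ false → g a ≡ true → suc (count f) ≤ count g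
count-strict f g e zero p q rewrite p | q =
  s≤s (count-mono (λ x → f (suc x)) (λ x → g (suc x)) (λ x → e (suc x)))
count-strict f g e (suc a) p q =
  subst (_≤ count g) (+-suc (bit (f zero)) _)
    (+-mono-≤ (bit-mono (e zero)) (count-strict (λ x → f (suc x)) (λ x → g (suc x)) (λ x → e (suc x)) a p q))

count-none : ∀ {n} (f : Fin n → Bool) → (∀ x → f x ≡ false) → count f ≡ 0
count-none {zero}  f e = refl
count-none {suc n} f e rewrite e zero = count-none (λ x → f (suc x)) (λ x → e (suc x))

count-all : ∀ {n} → count {n} (λ _ → true) ≡ n
count-all {zero}  = refl
count-all {suc n} = cong suc (count-all {n})

count-≤-size : ∀ {n} (f : Fin n → Bool) → count f ≤ n
count-≤-size {zero}  f = z≤n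
count-≤-size {suc n} f with f zero
... | true  = s≤s (count-≤-size (λ x → f (suc x)))
... | false = ≤-trans (count-≤-size (λ x → f (suc x))) (n≤1+n n)

count-pos : ∀ {n} (f : Fin n → Bool) a → f a ≡ true → 1 ≤ count f
count-pos f zero    p rewrite p = s≤s z≤n
count-pos f (suc a) p = ≤-trans (count-pos (λ x → f (suc x)) a p) (m≤n+m _ (bit (f zero)))

count-complement : ∀ {n} (f : Fin n → Bool) → count (λ x → not (f x)) + count f ≡ n
count-complement {zero}  f = refl
count-complement {suc n} f with f zero
... | true  = trans (+-suc _ _) (cong suc (count-complement (λ x → f (suc x))))
... | false = cong suc (count-complement (λ x → f (suc x)))

count-+ : ∀ m {n} (f : Fin (m + n) → Bool) →
          count f ≡ count (λ i → f (i ↑ˡ n)) + count (λ i → f (m ↑ʳ i))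
count-+ zero    f = refl
count-+ (suc m) f =
  trans (cong (bit (f zero) +_) (count-+ m (λ x → f (suc x)))) (sym (+-assoc (bit (f zero)) _ _))

count-punchIn : ∀ {n} (g : Fin (suc n) → Bool) p →
                count g ≡ bit (g p) + count (λ x → g (punchIn p x))
count-punchIn g zero = refl
count-punchIn {suc n} g (suc p) =
  trans (cong (bit (g zero) +_) (count-punchIn (λ x → g (suc x)) p)) (x∙yz≈y∙xz (bit (g zero)) (bit (g (suc p))) (count (λ x → g (suc (punchIn p x)))))

count-injection : ∀ {a b} (f : Fin a → Bool) (g : Fin b → Bool) (h : Fin a → Fin b) →
  (∀ x y → h x ≡ h y → x ≡ y) → (∀ x → f x ≡ true → g (h x) ≡ true) → count f ≤ count g
count-injection {zero}  f g h inj pres = z≤n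
count-injection {suc a} {zero} f g h inj pres with h zero
... | ()
count-injection {suc a} {suc b} f g h inj pres =
  subst (count f ≤_) (sym (count-punchIn g (h zero)))
    (+-mono-≤ (bit-mono (pres zero))
      (count-injection (λ x → f (suc x)) (λ x → g (punchIn (h zero) x)) h'
        (λ x y e → suc-injective (inj (suc x) (suc y) (punchOut-injective (apart x) (apart y) e)))
        (λ x p → subst (λ z → g z ≡ true) (sym (punchIn-punchOut (apart x))) (pres (suc x) p))))
  where
  apart : ∀ x → h zero ≢ h (suc x)
  apart x e with inj zero (suc x) e
  ... | ()
  h' : Fin a → Fin b
  h' x = punchOut (apart x)

count-two : ∀ {n} (f : Fin n → Bool) a b → f a ≡ true → f b ≡ true → a ≢ b → 2 ≤ count f
count-two f a b p q ne = count-injection {2} (λ _ → true) f pair pair-injective pair-in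
  where
  pair : Fin 2 → _
  pair zero    = a
  pair (suc _) = b
  pair-injective : ∀ x y → pair x ≡ pair y → x ≡ y
  pair-injective zero       zero       _ = refl
  pair-injective zero       (suc zero) e = ⊥-elim (ne e)
  pair-injective (suc zero) zero       e = ⊥-elim (ne (sym e))
  pair-injective (suc zero) (suc zero) _ = refl
  pair-in : ∀ x → true ≡ true → f (pair x) ≡ true
  pair-in zero    _ = p
  pair-in (suc _) _ = q

count-one⇒unique : ∀ {n} (f : Fin n → Bool) → count f ≡ 1 →
                   ∀ a b → f a ≡ true → f b ≡ true → a ≡ b
count-one⇒unique f e a b p q with a ≟ b
... | yes a≡b = a≡b
... | no  a≢b = ⊥-elim (n≮n 1 (subst (2 ≤_) e (count-two f a b p q a≢b)))

count-≤1 : ∀ {n} (f : Fin n → Bool) → (∀ a b → f a ≡ true → f b ≡ true → a ≡ b) → count f ≤ 1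
count-≤1 {zero}  f u = z≤n
count-≤1 {suc n} f u with f zero in eq
... | true  = subst (_≤ 1) (sym (cong suc (count-none (λ x → f (suc x)) rest-empty))) ≤-refl
  where
  rest-empty : ∀ x → f (suc x) ≡ false
  rest-empty x = ¬-not (λ p → zero≢suc (u zero (suc x) eq p))
    where zero≢suc : ∀ {k} {y : Fin k} → Fin.zero ≢ suc y
          zero≢suc ()
... | false = count-≤1 (λ x → f (suc x)) (λ a b p q → suc-injective (u (suc a) (suc b) p q))

count-singleton : ∀ {n} (f : Fin n → Bool) a → f a ≡ true → (∀ b → f b ≡ true → b ≡ a) → count f ≡ 1
count-singleton f a p u =
  ≤-antisym (count-≤1 f (λ x y q r → trans (u x q) (sym (u y r)))) (count-pos f a p)

-- Enumerating a Boolean subset P of Fin N:  nth P : Fin (count P) → Fin N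
-- lists the members of P in increasing order and  rank P  is its inverse.

mutual
  nth : ∀ {N} (P : Fin N → Bool) → Fin (count P) → Fin N
  nth {suc N} P k = nth-from P (P zero) k

  nth-from : ∀ {N} (P : Fin (suc N) → Bool) (b : Bool) →
             Fin (bit b + count (λ x → P (suc x))) → Fin (suc N)
  nth-from P true  zero    = zero
  nth-from P true  (suc k) = suc (nth (λ x → P (suc x)) k)
  nth-from P false k       = suc (nth (λ x → P (suc x)) k)

mutual
  nth-member : ∀ {N} (P : Fin N → Bool) k → P (nth P k) ≡ true
  nth-member {suc N} P k = nth-from-member P (P zero) refl k

  nth-from-member : ∀ {N} (P : Fin (suc N) → Bool) b → P zero ≡ b → ∀ k → P (nth-from P b k) ≡ true
  nth-from-member P true  eq zero    = eq
  nth-from-member P true  eq (suc k) = nth-member (λ x → P (suc x)) k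
  nth-from-member P false eq k       = nth-member (λ x → P (suc x)) k

mutual
  nth-injective : ∀ {N} (P : Fin N → Bool) k k' → nth P k ≡ nth P k' → k ≡ k'
  nth-injective {suc N} P k k' e = nth-from-injective P (P zero) k k' e

  nth-from-injective : ∀ {N} (P : Fin (suc N) → Bool) b k k' → nth-from P b k ≡ nth-from P b k' → k ≡ k'
  nth-from-injective P true  zero    zero     e  = refl
  nth-from-injective P true  zero    (suc k') ()
  nth-from-injective P true  (suc k) zero     ()
  nth-from-injective P true  (suc k) (suc k') e  = cong suc (nth-injective (λ x → P (suc x)) k k' (suc-injective e))
  nth-from-injective P false k       k'       e  = nth-injective (λ x → P (suc x)) k k' (suc-injective e)

mutual
  rank : ∀ {N} (P : Fin N → Bool) (z : Fin N) → P z ≡ true → Fin (count P)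
  rank {suc N} P z p = rank-from P (P zero) refl z p

  rank-from : ∀ {N} (P : Fin (suc N) → Bool) b → P zero ≡ b → (z : Fin (suc N)) → P z ≡ true →
              Fin (bit b + count (λ x → P (suc x)))
  rank-from P true  eq zero    p = zero
  rank-from P true  eq (suc z) p = suc (rank (λ x → P (suc x)) z p)
  rank-from P false eq zero    p = ⊥-elim (contradictory p eq)
  rank-from P false eq (suc z) p = rank (λ x → P (suc x)) z p

mutual
  nth-rank : ∀ {N} (P : Fin N → Bool) z p → nth P (rank P z p) ≡ z
  nth-rank {suc N} P z p = nth-rank-from P (P zero) refl z p

  nth-rank-from : ∀ {N} (P : Fin (suc N) → Bool) b (eq : P zero ≡ b) z p →
                  nth-from P b (rank-from P b eq z p) ≡ z
  nth-rank-from P true  eq zero    p = refl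
  nth-rank-from P true  eq (suc z) p = cong suc (nth-rank (λ x → P (suc x)) z p)
  nth-rank-from P false eq zero    p = ⊥-elim (contradictory p eq)
  nth-rank-from P false eq (suc z) p = cong suc (nth-rank (λ x → P (suc x)) z p)

rank-nth : ∀ {N} (P : Fin N → Bool) k p → rank P (nth P k) p ≡ k
rank-nth P k p = nth-injective P _ _ (nth-rank P (nth P k) p)

rank-cong : ∀ {N} (P : Fin N → Bool) z z' p p' → z ≡ z' → rank P z p ≡ rank P z' p'
rank-cong P z .z p p' refl = nth-injective P _ _ (trans (nth-rank P z p) (sym (nth-rank P z p')))

mutual
  count-∘nth : ∀ {N} (P g : Fin N → Bool) → count (λ k → g (nth P k)) ≡ count (λ z → P z ∧ g z)
  count-∘nth {zero}  P g = refl
  count-∘nth {suc N} P g = count-∘nth-from P (P zero) g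

  count-∘nth-from : ∀ {N} (P : Fin (suc N) → Bool) b (g : Fin (suc N) → Bool) →
    count (λ k → g (nth-from P b k)) ≡ bit (b ∧ g zero) + count (λ z → P (suc z) ∧ g (suc z))
  count-∘nth-from P true  g = cong (bit (g zero) +_) (count-∘nth (λ x → P (suc x)) (λ x → g (suc x)))
  count-∘nth-from P false g = count-∘nth (λ x → P (suc x)) (λ x → g (suc x))

↪-refl : ∀ {a} → a ↪ a
↪-refl = record { fun = λ x → x ; injective = λ _ _ p → p ; adj-pres = λ _ _ → refl ; fat-pres = λ _ → refl }

↪-trans : ∀ {a b c} → a ↪ b → b ↪ c → a ↪ c
↪-trans e f = record
  { fun       = λ x → fun f (fun e x)
  ; injective = λ x y p → injective e x y (injective f _ _ p)
  ; adj-pres  = λ x y → trans (adj-pres f (fun e x) (fun e y)) (adj-pres e x y)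
  ; fat-pres  = λ x → trans (fat-pres f (fun e x)) (fat-pres e x) }

≅-refl : ∀ {a} → a ≅ a
≅-refl = record { emb = ↪-refl ; surjective = λ y → y , refl }

≅-trans : ∀ {a b c} → a ≅ b → b ≅ c → a ≅ c
≅-trans i j = record
  { emb        = ↪-trans (emb i) (emb j)
  ; surjective = λ z → let (y , p) = surjective j z ; (x , q) = surjective i y
                       in x , trans (cong (fun (emb j)) q) p }

≅-sym : ∀ {a b} → a ≅ b → b ≅ a
≅-sym {a} {b} i = record
  { emb = record
    { fun       = inv
    ; injective = λ y y' p → trans (sym (fun-inv y)) (trans (cong φ p) (fun-inv y'))
    ; adj-pres  = λ y y' → trans (sym (adj-pres (emb i) (inv y) (inv y'))) (cong₂ (adj b) (fun-inv y) (fun-inv y'))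
    ; fat-pres  = λ y → trans (sym (fat-pres (emb i) (inv y))) (cong (fat b) (fun-inv y)) }
  ; surjective = λ x → φ x , injective (emb i) _ _ (fun-inv (φ x)) }
  where
  φ = fun (emb i)
  inv : Fin (n b) → Fin (n a)
  inv y = proj₁ (surjective i y)
  fun-inv : ∀ y → φ (inv y) ≡ y
  fun-inv y = proj₂ (surjective i y)

↪-factor : ∀ {Q P h} (e : Q ↪ h) (f : P ↪ h) → (∀ q → ∃[ a ] (fun f a ≡ fun e q)) → Q ↪ P
↪-factor {Q} {P} {h} e f lift = record
  { fun       = λ q → proj₁ (lift q)
  ; injective = λ q q' eq → injective e q q' (trans (sym (proj₂ (lift q))) (trans (cong (fun f) eq) (proj₂ (lift q'))))
  ; adj-pres  = λ q q' → trans (sym (adj-pres f _ _)) (trans (cong₂ (adj h) (proj₂ (lift q)) (proj₂ (lift q'))) (adj-pres e q q'))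
  ; fat-pres  = λ q → trans (sym (fat-pres f _)) (trans (cong (fat h) (proj₂ (lift q))) (fat-pres e q)) }

slimCount-↪ : ∀ {a b} → a ↪ b → slimCount a ≤ slimCount b
slimCount-↪ e = count-injection _ _ (fun e) (injective e) (λ x p → trans (cong not (fat-pres e x)) p)

fatCount-↪ : ∀ {a b} → a ↪ b → fatCount a ≤ fatCount b
fatCount-↪ e = count-injection _ _ (fun e) (injective e) (λ x p → trans (fat-pres e x) p)

slimCount-≅ : ∀ {a b} → a ≅ b → slimCount a ≡ slimCount b
slimCount-≅ i = ≤-antisym (slimCount-↪ (emb i)) (slimCount-↪ (emb (≅-sym i)))

fatCount-≅ : ∀ {a b} → a ≅ b → fatCount a ≡ fatCount b
fatCount-≅ i = ≤-antisym (fatCount-↪ (emb i)) (fatCount-↪ (emb (≅-sym i)))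

injective⇒surjective : ∀ {a b} (f : Fin a → Fin b) → (∀ x y → f x ≡ f y → x ≡ y) → b ≤ a →
                       ∀ y → ∃[ x ] (f x ≡ y)
injective⇒surjective {a} {b} f inj b≤a y with anyFin (λ x → f x == y) in hit
... | true  = let (x , p) = anyFin-witness (λ x → f x == y) hit in x , ==-sound (f x) y p
... | false = ⊥-elim (n≮n a (≤-trans (s≤s image-size) (≤-trans missing-y b≤a)))
  where
  others : Fin b → Bool
  others z = not (z == y)
  image-size : a ≤ count others
  image-size = subst (_≤ count others) count-all
    (count-injection (λ _ → true) others f inj (λ x _ → cong not (anyFin-false (λ x → f x == y) hit x)))
  missing-y : suc (count others) ≤ b
  missing-y = subst (suc (count others) ≤_)
    (trans (cong (count others +_) (sym (count-singleton (_== y) y (==-refl y) (λ z p → ==-sound z y p))))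
           (count-complement (_== y)))
    (subst (_≤ count others + 1) (+-comm (count others) 1) ≤-refl)

↪-same-size⇒≅ : ∀ {a b} → (e : a ↪ b) → n b ≤ n a → a ≅ b
↪-same-size⇒≅ e le = record { emb = e ; surjective = injective⇒surjective (fun e) (injective e) le }

size-slim-fat : ∀ h → n h ≡ slimCount h + fatCount h
size-slim-fat h = sym (count-complement (fat h))

-- Pre-Hoffman graphs (Hoffman graphs without the requirement that every
-- fat vertex has a slim neighbour) and their induced Hoffman subgraphs

record PreHoffman : Set where
  field
    size        : ℕ
    adjᵖ        : Fin size → Fin size → Bool
    fatᵖ        : Fin size → Bool
    adjᵖ-sym    : ∀ x y → adjᵖ x y ≡ adjᵖ y x
    adjᵖ-irrefl : ∀ x → adjᵖ x x ≡ false
    fatᵖ-indep  : ∀ x y → fatᵖ x ≡ true → fatᵖ y ≡ true → adjᵖ x y ≡ false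

open PreHoffman public

HasSlimNbrs : (R : PreHoffman) → (Fin (size R) → Bool) → Set
HasSlimNbrs R P = ∀ z → P z ≡ true → fatᵖ R z ≡ true →
                  ∃[ w ] (P w ≡ true × adjᵖ R z w ≡ true × fatᵖ R w ≡ false)

Induced : (R : PreHoffman) (P : Fin (size R) → Bool) → HasSlimNbrs R P → HoffmanGraph
Induced R P hs = record
  { n            = count P
  ; adj          = λ i j → adjᵖ R (nth P i) (nth P j)
  ; fat          = λ i → fatᵖ R (nth P i)
  ; adj-sym      = λ i j → adjᵖ-sym R (nth P i) (nth P j)
  ; adj-irrefl   = λ i → adjᵖ-irrefl R (nth P i)
  ; fat-indep    = λ i j → fatᵖ-indep R (nth P i) (nth P j)
  ; fat-has-slim = λ i p →
      let (w , Pw , a , f) = hs (nth P i) (nth-member P i) p in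
      rank P w Pw , subst (λ u → adjᵖ R (nth P i) u ≡ true) (sym (nth-rank P w Pw)) a
                  , subst (λ u → fatᵖ R u ≡ false) (sym (nth-rank P w Pw)) f }

Induced-⊆ : (R : PreHoffman) (P P' : Fin (size R) → Bool) (hs : HasSlimNbrs R P) (hs' : HasSlimNbrs R P') →
            (∀ z → P z ≡ true → P' z ≡ true) → Induced R P hs ↪ Induced R P' hs'
Induced-⊆ R P P' hs hs' P⊆P' = record
  { fun       = λ k → rank P' (nth P k) (P⊆P' _ (nth-member P k))
  ; injective = λ k k' e → nth-injective P k k'
                  (trans (sym (nth-rank P' _ _)) (trans (cong (nth P') e) (nth-rank P' _ _)))
  ; adj-pres  = λ k k' → cong₂ (adjᵖ R) (nth-rank P' _ _) (nth-rank P' _ _)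
  ; fat-pres  = λ k → cong (fatᵖ R) (nth-rank P' _ _) }

slim-vertex : (h : HoffmanGraph) → 0 < n h → ∃[ x ] (fat h x ≡ false)
slim-vertex h nonempty with fat h (fromℕ< nonempty) in isFat
... | false = fromℕ< nonempty , isFat
... | true  = let (w , _ , slim-w) = fat-has-slim h (fromℕ< nonempty) isFat in w , slim-w

𝔥₂-slim-zero : ∀ z → fat 𝔥₂ z ≡ false → z ≡ zero
𝔥₂-slim-zero zero _ = refl
𝔥₂-slim-zero (suc zero) ()
𝔥₂-slim-zero (suc (suc zero)) ()

sum-common-fat⇒adjacent :
  ∀ {h k part emb} → IsSum h {k} part emb →
  ∀ i j (x : Fin (n (part i))) (y : Fin (n (part j))) → i ≢ j →
  fat (part i) x ≡ false → fat (part j) y ≡ false →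
  ∀ z → fat h z ≡ true → adj h (fun (emb i) x) z ≡ true → adj h (fun (emb j) y) z ≡ true →
  adj h (fun (emb i) x) (fun (emb j) y) ≡ true
sum-common-fat⇒adjacent {h} {emb = e} S i j x y i≢j slim-x slim-y z fat-z xz yz =
  proj₁ (IsSum.common-eq S i j x y i≢j slim-x slim-y)
    (≤-antisym (IsSum.common-le S i j x y i≢j slim-x slim-y)
               (count-pos (λ u → fat h u ∧ (adj h (fun (e i) x) u ∧ adj h (fun (e j) y) u)) z
                          (∧-true fat-z (∧-true xz yz))))

FSum-map : ∀ {F F' h} → (∀ g → g ∈̂ F → g ∈̂ F') → FSum F h → FSum F' h
FSum-map F⊆F' S = record { k = FSum.k S ; part = FSum.part S ; emb = FSum.emb S
                         ; inF = λ i → F⊆F' _ (FSum.inF S i) ; isSum = FSum.isSum S }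

Cover-map : ∀ {F F' G} → (∀ g → g ∈̂ F → g ∈̂ F') → Cover F G → Cover F' G
Cover-map F⊆F' C = record { host = host C ; sum = FSum-map F⊆F' (sum C) ; embed = embed C }

StrictCover-map : ∀ {F F' G} → (∀ g → g ∈̂ F → g ∈̂ F') → StrictCover F G → StrictCover F' G
StrictCover-map F⊆F' C = record { cover = Cover-map F⊆F' (cover C) ; strict = strict C }

maxOver : ∀ {k} → (Fin k → ℕ) → ℕ
maxOver {zero}  f = 0
maxOver {suc k} f = f zero ⊔ maxOver (λ i → f (suc i))

maxOver-≥ : ∀ {k} (f : Fin k → ℕ) i → f i ≤ maxOver f
maxOver-≥ f zero    = m≤m⊔n _ _
maxOver-≥ f (suc i) = ≤-trans (maxOver-≥ (λ i → f (suc i)) i) (m≤n⊔m (f zero) _)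

module Truncation (H : Family) (E : Enumeration (Hbar H)) where
  open Enumeration E

  truncate⊆Hbar : ∀ m h → h ∈̂ truncate E m → h ∈̂ Hbar H
  truncate⊆Hbar m h (h' , (i , _ , valid , h'≅gi) , h≅h') =
    let (h'' , Hbar-h'' , gi≅h'') = sound i valid in h'' , Hbar-h'' , ≅-trans h≅h' (≅-trans h'≅gi gi≅h'')

  H⊆Hbar : (∀ h → H h → 𝒪 h) → ∀ h → h ∈̂ H → h ∈̂ Hbar H
  H⊆Hbar H⊆𝒪 h (h' , H-h' , h≅h') = h' , inj₂ (H⊆𝒪 h' H-h' , h' , H-h' , ↪-refl) , h≅h'

  indexOf : ∀ h → h ∈̂ Hbar H → ℕ
  indexOf h (h' , Hbar-h' , _) = proj₁ (complete h' (h' , Hbar-h' , ≅-refl))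

  ∈truncate : ∀ M h (p : h ∈̂ Hbar H) → indexOf h p ≤ M → h ∈̂ truncate E M
  ∈truncate M h (h' , Hbar-h' , h≅h') le =
    let (j , valid , h'≅gj) = complete h' (h' , Hbar-h' , ≅-refl) in
    g j , (j , le , valid , ≅-refl) , ≅-trans h≅h' h'≅gj

  coverIndex : ∀ {G} → Cover (Hbar H) G → ℕ
  coverIndex C = maxOver (λ i → indexOf _ (FSum.inF (sum C) i))

  Cover-truncate : ∀ {G} (C : Cover (Hbar H) G) M → coverIndex C ≤ M → Cover (truncate E M) G
  Cover-truncate C M le = record
    { host  = host C
    ; sum   = record
      { k = FSum.k (sum C) ; part = FSum.part (sum C) ; emb = FSum.emb (sum C)
      ; inF = λ i → ∈truncate M _ (FSum.inF (sum C) i) (≤-trans (maxOver-≥ _ i) le)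
      ; isSum = FSum.isSum (sum C) }
    ; embed = embed C }

  StrictCover-truncate : ∀ {G} (C : StrictCover (Hbar H) G) M → coverIndex (cover C) ≤ M →
                         StrictCover (truncate E M) G
  StrictCover-truncate C M le = record { cover = Cover-truncate (cover C) M le ; strict = strict C }

  Hbar-one-slim⇒𝔥₂ : ∀ h → Hbar H h → slimCount h ≤ 1 → h ≅ 𝔥₂
  Hbar-one-slim⇒𝔥₂ h (inj₁ h≅𝔥₂) _ = h≅𝔥₂
  Hbar-one-slim⇒𝔥₂ h (inj₂ (inj₁ h≅𝔥₂ , _)) _ = h≅𝔥₂
  Hbar-one-slim⇒𝔥₂ h (inj₂ (inj₂ (_ , _ , two-slim , _) , _)) le with ≤-trans two-slim le
  ... | s≤s ()

  -- 𝔥₂ has the fewest slim vertices in H̄, so it is g₀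
  index-𝔥₂ : ∀ j → Valid j → 𝔥₂ ≅ g j → j ≡ 0
  index-𝔥₂ zero    _     _ = refl
  index-𝔥₂ (suc j) valid 𝔥₂≅gj with sound 0 (valid-down 0 (suc j) z≤n valid)
  ... | (h , Hbar-h , g0≅h) = ⊥-elim (0≢suc (distinct 0 (suc j) valid0 valid g0≅gj))
    where
    valid0 = valid-down 0 (suc j) z≤n valid
    one-slim : slimCount h ≤ 1
    one-slim = subst (_≤ 1) (slimCount-≅ g0≅h)
                 (subst (slimCount (g 0) ≤_) (sym (slimCount-≅ 𝔥₂≅gj)) (monotone 0 (suc j) valid0 valid z≤n))
    g0≅gj = ≅-trans g0≅h (≅-trans (Hbar-one-slim⇒𝔥₂ h Hbar-h one-slim) 𝔥₂≅gj)
    0≢suc : ∀ {k} → 0 ≢ suc k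
    0≢suc ()

  𝔥₂∈truncate : ∀ m Q → Q ≅ 𝔥₂ → Q ∈̂ truncate E m
  𝔥₂∈truncate m Q Q≅𝔥₂ with complete 𝔥₂ (𝔥₂ , inj₁ ≅-refl , ≅-refl)
  ... | (j , valid , 𝔥₂≅gj) =
    g j , (j , subst (_≤ m) (sym (index-𝔥₂ j valid 𝔥₂≅gj)) z≤n , valid , ≅-refl) , ≅-trans Q≅𝔥₂ 𝔥₂≅gj

  fewer-slim⇒earlier : ∀ i j → Valid i → Valid j → slimCount (g j) < slimCount (g i) → j ≤ i
  fewer-slim⇒earlier i j valid-i valid-j lt with ≤-total j i
  ... | inj₁ j≤i = j≤i
  ... | inj₂ i≤j = ⊥-elim (<-irrefl refl (<-≤-trans lt (monotone i j valid-i valid-j i≤j)))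

  truncate-↪-closed : ∀ m Q P → Q ↪ P → fatCount Q ≡ fatCount P →
                      Hbar H Q → P ∈̂ truncate E m → Q ∈̂ truncate E m
  truncate-↪-closed m Q P Q↪P same-fat Hbar-Q (P' , (i , i≤m , valid-i , P'≅gi) , P≅P') =
    g j , (j , j≤m (m≤n⇒m<n∨m≡n (slimCount-↪ Q↪P)) , valid-j , ≅-refl) , Q≅gj
    where
    located = complete Q (Q , Hbar-Q , ≅-refl)
    j = proj₁ located
    valid-j = proj₁ (proj₂ located)
    Q≅gj = proj₂ (proj₂ located)
    P≅gi = ≅-trans P≅P' P'≅gi
    j≤m : (slimCount Q < slimCount P) ⊎ (slimCount Q ≡ slimCount P) → j ≤ m
    j≤m (inj₁ lt) = ≤-trans (fewer-slim⇒earlier i j valid-i valid-j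
                              (subst₂ _<_ (slimCount-≅ Q≅gj) (slimCount-≅ P≅gi) lt)) i≤m
    j≤m (inj₂ same-slim) = subst (_≤ m) (sym (distinct j i valid-j valid-i gj≅gi)) i≤m
      where
      same-size : n P ≤ n Q
      same-size = ≤-reflexive (trans (size-slim-fat P)
                    (trans (cong₂ _+_ (sym same-slim) (sym same-fat)) (sym (size-slim-fat Q))))
      gj≅gi = ≅-trans (≅-sym Q≅gj) (≅-trans (↪-same-size⇒≅ Q↪P same-size) P≅gi)

  -- (1) ⇒ (2), uniqueness: strict ℋ(m)-covers are strict H̄-covers
  unique-restricts : ∀ m G → StrictCover (truncate E m) G →
                     UniqueStrictCover (Hbar H) G → UniqueStrictCover (truncate E m) G
  unique-restricts m G c unique =
    c , λ c₁ c₂ → proj₂ unique (StrictCover-map (truncate⊆Hbar m) c₁) (StrictCover-map (truncate⊆Hbar m) c₂)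

  -- (2) ⇒ (1): an H-cover of G is an ℋ(M)-cover for M large, and any two
  -- strict H̄-covers are strict ℋ(M)-covers for a common M
  unique-extends : (∀ h → H h → 𝒪 h) → ∀ G → IsLineGraph H G →
    ((m : ℕ) → IsLineGraph (truncate E m) G → UniqueStrictCover (truncate E m) G) →
    UniqueStrictCover (Hbar H) G
  unique-extends H⊆𝒪 G H-cover unique-at =
    StrictCover-map (truncate⊆Hbar M) (proj₁ (unique-at M (Cover-truncate Hbar-cover M ≤-refl))) ,
    λ c₁ c₂ → let M' = coverIndex (cover c₁) ⊔ coverIndex (cover c₂)
                  c₁' = StrictCover-truncate c₁ M' (m≤m⊔n _ _)
                  c₂' = StrictCover-truncate c₂ M' (m≤n⊔m _ _)
              in proj₂ (unique-at M' (cover c₁')) c₁' c₂'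
    where
    Hbar-cover = Cover-map (H⊆Hbar H⊆𝒪) H-cover
    M = coverIndex Hbar-cover

-- Connected components of a symmetric Boolean relation R on Fin n.
-- reach j x y: y can be reached from x in at most j R-steps; since the set
-- reached from x grows strictly until it stabilises, n steps suffice, and
-- "connected" is reach n.

module Components (n : ℕ) (R : Fin n → Fin n → Bool) (R-sym : ∀ x y → R x y ≡ R y x) where

  reach : ℕ → Fin n → Fin n → Bool
  reach zero    x y = x == y
  reach (suc j) x y = reach j x y ∨ anyFin (λ z → reach j x z ∧ R z y)

  reach-suc : ∀ j x y → reach j x y ≡ true → reach (suc j) x y ≡ true
  reach-suc j x y = ∨-trueˡ

  reach-+ : ∀ j d x y → reach j x y ≡ true → reach (d + j) x y ≡ true
  reach-+ j zero    x y p = p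
  reach-+ j (suc d) x y p = reach-suc (d + j) x y (reach-+ j d x y p)

  reach-step : ∀ j x z y → reach j x z ≡ true → R z y ≡ true → reach (suc j) x y ≡ true
  reach-step j x z y p q = ∨-trueʳ {reach j x y} (anyFin-intro (λ w → reach j x w ∧ R w y) z (∧-true p q))

  reach-cases : ∀ j x y → reach (suc j) x y ≡ true →
                (reach j x y ≡ true) ⊎ ∃[ z ] (reach j x z ≡ true × R z y ≡ true)
  reach-cases j x y p with ∨-true-cases {reach j x y} p
  ... | inj₁ q = inj₁ q
  ... | inj₂ q = let (z , r) = anyFin-witness _ q in inj₂ (z , ∧-trueˡ r , ∧-trueʳ r)

  reach-prepend : ∀ j x z y → R x z ≡ true → reach j z y ≡ true → reach (suc j) x y ≡ true
  reach-prepend zero x z y e p with ==-sound z y p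
  ... | refl = reach-step zero x x z (==-refl x) e
  reach-prepend (suc j) x z y e p with reach-cases j z y p
  ... | inj₁ q = reach-suc (suc j) x y (reach-prepend j x z y e q)
  ... | inj₂ (w , q , r) = reach-step (suc j) x w y (reach-prepend j x z w e q) r

  reach-sym : ∀ j x y → reach j x y ≡ true → reach j y x ≡ true
  reach-sym zero    x y p = trans (==-sym y x) p
  reach-sym (suc j) x y p with reach-cases j x y p
  ... | inj₁ q = reach-suc j y x (reach-sym j x y q)
  ... | inj₂ (z , q , r) = reach-prepend j y z x (trans (R-sym y z) r) (reach-sym j x z q)

  reach-induction : (Inv : Fin n → Set) → (∀ z y → Inv z → R z y ≡ true → Inv y) →
                    ∀ j x y → Inv x → reach j x y ≡ true → Inv y
  reach-induction Inv step zero x y inv p with ==-sound x y p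
  ... | refl = inv
  reach-induction Inv step (suc j) x y inv p with reach-cases j x y p
  ... | inj₁ q = reach-induction Inv step j x y inv q
  ... | inj₂ (z , q , e) = step z y (reach-induction Inv step j x z inv q) e

  Stable : ℕ → Fin n → Set
  Stable j x = ∀ y → reach (suc j) x y ≡ true → reach j x y ≡ true

  stable-suc : ∀ j x → Stable j x → Stable (suc j) x
  stable-suc j x st y p with reach-cases (suc j) x y p
  ... | inj₁ q = q
  ... | inj₂ (z , q , r) = reach-step j x z y (st z q) r

  stable-collapse : ∀ j d x → Stable j x → ∀ y → reach (d + j) x y ≡ true → reach j x y ≡ true
  stable-collapse j zero    x st y p = p
  stable-collapse j (suc d) x st y p = stable-collapse j d x st y (stable-+ d y p)
    where
    stable-+ : ∀ d → Stable (d + j) x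
    stable-+ zero    = st
    stable-+ (suc d) = stable-suc (d + j) x (stable-+ d)

  grows-or-stable : ∀ j x → (suc j ≤ count (reach j x)) ⊎ ∃[ j₀ ] (j₀ ≤ j × Stable j₀ x)
  grows-or-stable zero x = inj₁ (count-pos (reach zero x) x (==-refl x))
  grows-or-stable (suc j) x with grows-or-stable j x
  ... | inj₂ (j₀ , le , st) = inj₂ (j₀ , ≤-trans le (n≤1+n j) , st)
  ... | inj₁ c with anyFin (λ y → reach (suc j) x y ∧ not (reach j x y)) in new
  ... | false = inj₂ (j , n≤1+n j , nothing-new)
    where
    nothing-new : Stable j x
    nothing-new y p = not-injective
      (trans (cong (λ b → b ∧ not (reach j x y)) (sym p)) (anyFin-false _ new y))
  ... | true =
    let (y , p) = anyFin-witness _ new in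
    inj₁ (≤-trans (s≤s c) (count-strict (reach j x) (reach (suc j) x) (reach-suc j x) y
                                         (not-injective (∧-trueʳ p)) (∧-trueˡ p)))

  connected : Fin n → Fin n → Bool
  connected = reach n

  reach⇒connected : ∀ j x y → reach j x y ≡ true → connected x y ≡ true
  reach⇒connected j x y p with grows-or-stable n x
  ... | inj₁ too-many = ⊥-elim (n≮n n (≤-trans too-many (count-≤-size (reach n x))))
  ... | inj₂ (j₀ , j₀≤n , st) =
    let (d , j₀+d≡n) = m≤n⇒∃[o]m+o≡n j₀≤n
        at-j₀ = stable-collapse j₀ j x st y (subst (λ u → reach u x y ≡ true) (+-comm j₀ j) (reach-+ j j₀ x y p))
    in subst (λ u → reach u x y ≡ true) (trans (+-comm d j₀) j₀+d≡n) (reach-+ j₀ d x y at-j₀)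

  connected-refl : ∀ x → connected x x ≡ true
  connected-refl x = reach⇒connected zero x x (==-refl x)

  connected-sym : ∀ x y → connected x y ≡ true → connected y x ≡ true
  connected-sym = reach-sym n

  connected-step : ∀ x z y → connected x z ≡ true → R z y ≡ true → connected x y ≡ true
  connected-step x z y p q = reach⇒connected (suc n) x y (reach-step n x z y p q)

  R⇒connected : ∀ x y → R x y ≡ true → connected x y ≡ true
  R⇒connected x y = connected-step x x y (connected-refl x)

  connected-trans : ∀ x y z → connected x y ≡ true → connected y z ≡ true → connected x z ≡ true
  connected-trans x y z p q =
    reach-induction (λ w → connected x w ≡ true) (λ w w' c e → connected-step x w w' c e) n y z p q

  connected-induction : (Inv : Fin n → Set) → (∀ z y → Inv z → R z y ≡ true → Inv y) →
                        ∀ x y → Inv x → connected x y ≡ true → Inv y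
  connected-induction Inv step = reach-induction Inv step n

  rep : Fin n → Fin n
  rep x = proj₁ (least (connected x) x (connected-refl x))

  connected-rep : ∀ x → connected x (rep x) ≡ true
  connected-rep x = proj₁ (proj₂ (least (connected x) x (connected-refl x)))

  rep-least : ∀ x y → connected x y ≡ true → toℕ (rep x) ≤ toℕ y
  rep-least x = proj₂ (proj₂ (least (connected x) x (connected-refl x)))

  rep-cong : ∀ x y → connected x y ≡ true → rep x ≡ rep y
  rep-cong x y p = toℕ-injective (≤-antisym
    (rep-least x (rep y) (connected-trans x y (rep y) p (connected-rep y)))
    (rep-least y (rep x) (connected-trans y x (rep x) (connected-sym x y p) (connected-rep x))))

  isRep : Fin n → Bool
  isRep r = rep r == r

  isRep-rep : ∀ x → isRep (rep x) ≡ true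
  isRep-rep x = subst (λ u → u == rep x ≡ true) (rep-cong x (rep x) (connected-rep x)) (==-refl (rep x))

  isRep-unique : ∀ r x → isRep r ≡ true → connected r x ≡ true → r ≡ rep x
  isRep-unique r x p q = trans (sym (==-sound (rep r) r p)) (rep-cong r x q)

  linked : Fin n → Bool
  linked x = anyFin (R x)

  unlinked-component : ∀ r x → linked r ≡ false → connected r x ≡ true → x ≡ r
  unlinked-component r x unlinked =
    connected-induction (λ z → z ≡ r) (λ { z y refl e → ⊥-elim (contradictory (anyFin-intro (R z) y e) unlinked) })
                        r x refl

  linked-component : ∀ r x → linked r ≡ true → connected r x ≡ true → linked x ≡ true
  linked-component r x is-linked =
    connected-induction (λ z → linked z ≡ true) (λ z y _ e → anyFin-intro (R y) z (trans (R-sym y z) e))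
                        r x is-linked

-- Two vertices of a Hoffman graph
-- are fat-linked when they are non-adjacent and have a common fat
-- neighbour; such vertices are slim and, by condition (iv), cannot lie in
-- different summands of a sum.  Hence a Hoffman graph whose slim vertices
-- are all connected by fat-links is indecomposable.

fatLink : (h : HoffmanGraph) → Fin (n h) → Fin (n h) → Bool
fatLink h x y = not (adj h x y) ∧ anyFin (λ v → fat h v ∧ (adj h x v ∧ adj h y v))

fatLink-sym : (h : HoffmanGraph) → ∀ x y → fatLink h x y ≡ fatLink h y x
fatLink-sym h x y = cong₂ (λ a b → not a ∧ b) (adj-sym h x y)
  (anyFin-ext _ _ (λ v → cong (fat h v ∧_) (∧-comm (adj h x v) (adj h y v))))

fatLink-intro : (h : HoffmanGraph) → ∀ x y v → adj h x y ≡ false → fat h v ≡ true →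
                adj h x v ≡ true → adj h y v ≡ true → fatLink h x y ≡ true
fatLink-intro h x y v xy fat-v xv yv = ∧-true (cong not xy) (anyFin-intro _ v (∧-true fat-v (∧-true xv yv)))

fatLink-witness : (h : HoffmanGraph) → ∀ x y → fatLink h x y ≡ true →
  adj h x y ≡ false × ∃[ v ] (fat h v ≡ true × adj h x v ≡ true × adj h y v ≡ true)
fatLink-witness h x y l =
  let (v , s) = anyFin-witness _ (∧-trueʳ {not (adj h x y)} l) in
  not-injective (∧-trueˡ l) , v , ∧-trueˡ s , ∧-trueˡ (∧-trueʳ {fat h v} s) , ∧-trueʳ (∧-trueʳ {fat h v} s)

fatNbr⇒slim : (h : HoffmanGraph) → ∀ y v → fat h v ≡ true → adj h y v ≡ true → fat h y ≡ false
fatNbr⇒slim h y v fat-v yv = ¬-not (λ fat-y → contradictory yv (fat-indep h y v fat-y fat-v))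

module _ (h : HoffmanGraph) where
  open Components (n h) (fatLink h) (fatLink-sym h) using (connected; connected-induction)

  fatLinked-indecomposable : (∀ x y → fat h x ≡ false → fat h y ≡ false → connected x y ≡ true) →
                             Indecomposable h
  fatLinked-indecomposable all-connected (summand , emb₂ , S , nonempty) =
    0≢1 (IsSum.slim-disj S zero (suc zero) (proj₁ reached) w₁ (proj₁ (proj₂ reached)) (proj₂ (proj₂ reached)))
    where
    0≢1 : _≢_ {A = Fin 2} zero (suc zero)
    0≢1 ()
    slim₀ = slim-vertex (summand zero) (nonempty zero)
    slim₁ = slim-vertex (summand (suc zero)) (nonempty (suc zero))
    w₁ = proj₁ slim₁
    image-slim : ∀ i w → fat (summand i) w ≡ false → fat h (fun (emb₂ i) w) ≡ false
    image-slim i w slim = trans (fat-pres (emb₂ i) w) slim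
    preimage-slim : ∀ i w → fat h (fun (emb₂ i) w) ≡ false → fat (summand i) w ≡ false
    preimage-slim i w slim = trans (sym (fat-pres (emb₂ i) w)) slim
    -- being a slim vertex of summand 0 is preserved by fat-links
    InFirst : Fin (n h) → Set
    InFirst z = ∃[ w ] (fat (summand zero) w ≡ false × fun (emb₂ zero) w ≡ z)
    step : ∀ z y → InFirst z → fatLink h z y ≡ true → InFirst y
    step z y (w , slim-w , ew) l with fatLink-witness h z y l | IsSum.covers S y
    ... | _ , v , fat-v , _ , yv | zero , w' , refl =
      w' , preimage-slim zero w' (fatNbr⇒slim h _ v fat-v yv) , refl
    ... | zy , v , fat-v , zv , yv | suc zero , w' , refl =
      ⊥-elim (contradictory (subst (λ a → adj h a _ ≡ true) ew adjacent) zy)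
      where
      adjacent = sum-common-fat⇒adjacent S zero (suc zero) w w' 0≢1 slim-w
                   (preimage-slim (suc zero) w' (fatNbr⇒slim h _ v fat-v yv)) v fat-v
                   (subst (λ a → adj h a v ≡ true) (sym ew) zv) yv
    reached : InFirst (fun (emb₂ (suc zero)) w₁)
    reached = connected-induction InFirst step _ _ (proj₁ slim₀ , proj₂ slim₀ , refl)
      (all-connected _ _ (image-slim zero _ (proj₂ slim₀)) (image-slim (suc zero) _ (proj₂ slim₁)))

-- Parts with a single fat vertex: the members of H̄ other than 𝔥₂

record OneFatPart (H : Family) (P : HoffmanGraph) : Set where
  field
    fatCount-one : fatCount P ≡ 1
    isFat        : IsFat P
    inside-H     : ∃[ h ] (H h × P ↪ h)

  fat-unique : ∀ a b → fat P a ≡ true → fat P b ≡ true → a ≡ b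
  fat-unique = count-one⇒unique (fat P) fatCount-one

data PartKind (H : Family) (P : HoffmanGraph) : Set where
  copy-of-𝔥₂ : P ≅ 𝔥₂ → PartKind H P
  one-fat    : OneFatPart H P → PartKind H P

hasOneFat : ∀ {H P} → PartKind H P → Bool
hasOneFat (copy-of-𝔥₂ _) = false
hasOneFat (one-fat _)    = true

Hbar-kind : ∀ H P → P ∈̂ Hbar H → PartKind H P
Hbar-kind H P (h , inj₁ h≅𝔥₂ , P≅h) = copy-of-𝔥₂ (≅-trans P≅h h≅𝔥₂)
Hbar-kind H P (h , inj₂ (inj₁ h≅𝔥₂ , _) , P≅h) = copy-of-𝔥₂ (≅-trans P≅h h≅𝔥₂)
Hbar-kind H P (h , inj₂ (inj₂ (_ , fat-h , _ , one-fat-h) , h' , H-h' , h↪h') , P≅h) = one-fat record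
  { fatCount-one = trans (fatCount-≅ P≅h) one-fat-h
  ; isFat        = fat-P
  ; inside-H     = h' , H-h' , ↪-trans (emb P≅h) h↪h' }
  where
  φ = fun (emb P≅h)
  fat-P : IsFat P
  fat-P x slim-x =
    let (y , fat-y , xy) = fat-h (φ x) (trans (fat-pres (emb P≅h) x) slim-x)
        (w , φw≡y) = surjective P≅h y
    in w , trans (sym (fat-pres (emb P≅h) w)) (trans (cong (fat h) φw≡y) fat-y)
         , trans (sym (adj-pres (emb P≅h) x w)) (trans (cong (adj h (φ x)) φw≡y) xy)

-- Two vertices of G are *linked* when they are distinct, non-adjacent and
-- have a common fat neighbour in D.  Linked vertices lie in one part, which
-- has a single fat vertex; vertices in different linking components
-- satisfy the sum condition (iv) in D.

module CoverAnalysis (H : Family) (G : HoffmanGraph) (slimG : IsSlim G) (d : Cover (Hbar H) G) where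

  D : HoffmanGraph
  D = host d

  K : ℕ
  K = FSum.k (sum d)

  part : Fin K → HoffmanGraph
  part = FSum.part (sum d)

  partEmb : ∀ i → part i ↪ D
  partEmb = FSum.emb (sum d)

  D-sum : IsSum D part partEmb
  D-sum = FSum.isSum (sum d)

  kind : ∀ i → PartKind H (part i)
  kind i = Hbar-kind H (part i) (FSum.inF (sum d) i)

  inD : Fin (n G) → Fin (n D)
  inD = fun (embed d)

  inD-slim : ∀ x → fat D (inD x) ≡ false
  inD-slim x = trans (fat-pres (embed d) x) (slimG x)

  inD-injective : ∀ x y → inD x ≡ inD y → x ≡ y
  inD-injective = injective (embed d)

  inD-adj : ∀ x y → adj D (inD x) (inD y) ≡ adj G x y
  inD-adj = adj-pres (embed d)

  InPart : Fin (n G) → Fin K → Set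
  InPart x i = ∃[ x' ] (fun (partEmb i) x' ≡ inD x)

  partOf : Fin (n G) → Fin K
  partOf x = proj₁ (IsSum.covers D-sum (inD x))

  inPartOf : ∀ x → InPart x (partOf x)
  inPartOf x = proj₂ (IsSum.covers D-sum (inD x))

  InPart-slim : ∀ {x i} (p : InPart x i) → fat (part i) (proj₁ p) ≡ false
  InPart-slim {x} {i} (x' , e) = trans (sym (fat-pres (partEmb i) x')) (trans (cong (fat D) e) (inD-slim x))

  move : ∀ {x i j} → i ≡ j → InPart x i → InPart x j
  move refl p = p

  fatNbr-in-part : ∀ {x i} (p : InPart x i) v → fat D v ≡ true → adj D (inD x) v ≡ true →
                   ∃[ a ] (fun (partEmb i) a ≡ v × fat (part i) a ≡ true)
  fatNbr-in-part {x} {i} (x' , e) v fat-v xv =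
    let (a , ea) = IsSum.fat-nbrs D-sum i x' v (InPart-slim (x' , e)) fat-v (trans (cong (λ u → adj D u v) e) xv)
    in a , ea , trans (sym (fat-pres (partEmb i) a)) (trans (cong (fat D) ea) fat-v)

  -- a copy of 𝔥₂ contains only one slim vertex, hence only one vertex of G
  𝔥₂-part-single : ∀ {x y i} → part i ≅ 𝔥₂ → InPart x i → InPart y i → x ≡ y
  𝔥₂-part-single {x} {y} {i} c (x' , ex) (y' , ey) =
    inD-injective x y (trans (sym ex) (trans (cong (fun (partEmb i)) x'≡y') ey))
    where
    x'≡y' : x' ≡ y'
    x'≡y' = injective (emb c) x' y'
      (trans (𝔥₂-slim-zero _ (trans (fat-pres (emb c) x') (InPart-slim (x' , ex))))
             (sym (𝔥₂-slim-zero _ (trans (fat-pres (emb c) y') (InPart-slim (y' , ey))))))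

  oneFat-nbr : ∀ {x i} → OneFatPart H (part i) → InPart x i →
               ∃[ a ] (fat (part i) a ≡ true × adj D (inD x) (fun (partEmb i) a) ≡ true)
  oneFat-nbr {x} {i} P (x' , e) =
    let (a , fat-a , x'a) = OneFatPart.isFat P x' (InPart-slim (x' , e)) in
    a , fat-a , trans (cong (λ u → adj D u (fun (partEmb i) a)) (sym e)) (trans (adj-pres (partEmb i) x' a) x'a)

  commonFatG : Fin (n G) → Fin (n G) → ℕ
  commonFatG x y = commonFat D (inD x) (inD y)

  commonFatNbr : Fin (n G) → Fin (n G) → Fin (n D) → Bool
  commonFatNbr x y v = fat D v ∧ (adj D (inD x) v ∧ adj D (inD y) v)

  SumCondition : Fin (n G) → Fin (n G) → Set
  SumCondition x y = (commonFatG x y ≤ 1) × (commonFatG x y ≡ 1 → adj G x y ≡ true)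
                                          × (adj G x y ≡ true → commonFatG x y ≡ 1)

  different-parts : ∀ x y → partOf x ≢ partOf y → SumCondition x y
  different-parts x y i≢j =
    subst (_≤ 1) common≡ (IsSum.common-le D-sum (partOf x) (partOf y) x' y' i≢j slim-x slim-y)
    , (λ one → trans (sym (inD-adj x y)) (subst (_≡ true) adj≡ (proj₁ iv (trans common≡ one))))
    , (λ xy → trans (sym common≡) (proj₂ iv (subst (_≡ true) (sym adj≡) (trans (inD-adj x y) xy))))
    where
    x' = proj₁ (inPartOf x)
    y' = proj₁ (inPartOf y)
    slim-x = InPart-slim (inPartOf x)
    slim-y = InPart-slim (inPartOf y)
    common≡ : commonFat D (fun (partEmb (partOf x)) x') (fun (partEmb (partOf y)) y') ≡ commonFatG x y
    common≡ = cong₂ (commonFat D) (proj₂ (inPartOf x)) (proj₂ (inPartOf y))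
    adj≡ : adj D (fun (partEmb (partOf x)) x') (fun (partEmb (partOf y)) y') ≡ adj D (inD x) (inD y)
    adj≡ = cong₂ (adj D) (proj₂ (inPartOf x)) (proj₂ (inPartOf y))
    iv = IsSum.common-eq D-sum (partOf x) (partOf y) x' y' i≢j slim-x slim-y

  FatNbrsAgree : Fin (n G) → Fin (n G) → Set
  FatNbrsAgree x y = ∀ v w → fat D v ≡ true → adj D (inD x) v ≡ true →
                             fat D w ≡ true → adj D (inD y) w ≡ true → v ≡ w

  oneFat-agree : ∀ {x y i} → OneFatPart H (part i) → InPart x i → InPart y i → FatNbrsAgree x y
  oneFat-agree {i = i} P p q v w fat-v xv fat-w yw =
    let (a , ea , fat-a) = fatNbr-in-part p v fat-v xv
        (b , eb , fat-b) = fatNbr-in-part q w fat-w yw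
    in trans (sym ea) (trans (cong (fun (partEmb i)) (OneFatPart.fat-unique P a b fat-a fat-b)) eb)

  link : Fin (n G) → Fin (n G) → Bool
  link x y = not (x == y) ∧ fatLink D (inD x) (inD y)

  link-sym : ∀ x y → link x y ≡ link y x
  link-sym x y = cong₂ _∧_ (cong not (==-sym x y)) (fatLink-sym D (inD x) (inD y))

  link-nonadjacent : ∀ x y → link x y ≡ true → adj G x y ≡ false
  link-nonadjacent x y l = trans (sym (inD-adj x y)) (proj₁ (fatLink-witness D _ _ (∧-trueʳ {not (x == y)} l)))

  link-distinct : ∀ x y → link x y ≡ true → x ≢ y
  link-distinct x y l refl = contradictory (==-refl x) (not-injective (∧-trueˡ l))

  link-shareFat : ∀ x y → link x y ≡ true →
    ∃[ v ] (fat D v ≡ true × adj D (inD x) v ≡ true × adj D (inD y) v ≡ true)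
  link-shareFat x y l = proj₂ (fatLink-witness D _ _ (∧-trueʳ {not (x == y)} l))

  -- linked vertices lie in the same part, by condition (iv) of the sum D
  link-same-part : ∀ x y → link x y ≡ true → partOf x ≡ partOf y
  link-same-part x y l with partOf x ≟ partOf y
  ... | yes same = same
  ... | no  i≢j  = ⊥-elim (contradictory adjacent (link-nonadjacent x y l))
    where
    v = proj₁ (link-shareFat x y l)
    shared = proj₂ (link-shareFat x y l)
    adjacent : adj G x y ≡ true
    adjacent = trans (sym (inD-adj x y)) (subst₂ (λ u u' → adj D u u' ≡ true) (proj₂ (inPartOf x)) (proj₂ (inPartOf y))
      (sum-common-fat⇒adjacent D-sum (partOf x) (partOf y) _ _ i≢j (InPart-slim (inPartOf x)) (InPart-slim (inPartOf y)) v
        (proj₁ shared)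
        (subst (λ u → adj D u v ≡ true) (sym (proj₂ (inPartOf x))) (proj₁ (proj₂ shared)))
        (subst (λ u → adj D u v ≡ true) (sym (proj₂ (inPartOf y))) (proj₂ (proj₂ shared)))))

  link-oneFat : ∀ x y → link x y ≡ true → OneFatPart H (part (partOf x))
  link-oneFat x y l with kind (partOf x)
  ... | copy-of-𝔥₂ c =
    ⊥-elim (link-distinct x y l (𝔥₂-part-single c (inPartOf x) (move (sym (link-same-part x y l)) (inPartOf y))))
  ... | one-fat P = P

  open Components (n G) link link-sym public

  connected-same-part : ∀ x y → connected x y ≡ true → partOf x ≡ partOf y
  connected-same-part x y =
    connected-induction (λ z → partOf x ≡ partOf z) (λ z w same l → trans same (link-same-part z w l)) x y refl

  component-part : ∀ r x → connected r x ≡ true → InPart x (partOf r)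
  component-part r x c = move (sym (connected-same-part r x c)) (inPartOf x)

  linked-fatNbr : ∀ x → linked x ≡ true → ∃[ v ] (fat D v ≡ true × adj D (inD x) v ≡ true)
  linked-fatNbr x l = let (y , e) = anyFin-witness (link x) l ; (v , fat-v , xv , _) = link-shareFat x y e in v , fat-v , xv

  component-oneFat : ∀ r → linked r ≡ true → OneFatPart H (part (partOf r))
  component-oneFat r l = let (y , e) = anyFin-witness (link r) l in link-oneFat r y e

  unconnected-sumCondition : ∀ x y → x ≢ y → connected x y ≡ false → SumCondition x y
  unconnected-sumCondition x y x≢y unconnected with partOf x ≟ partOf y
  ... | no  i≢j  = different-parts x y i≢j
  ... | yes same with kind (partOf x)
  ...   | copy-of-𝔥₂ c = ⊥-elim (x≢y (𝔥₂-part-single c (inPartOf x) y-in))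
    where y-in = move (sym same) (inPartOf y)
  ...   | one-fat P = subst (_≤ 1) (sym common-one) ≤-refl , (λ _ → adjacent) , (λ _ → common-one)
    where
    y-in = move (sym same) (inPartOf y)
    nbr = oneFat-nbr P (inPartOf x)
    v = fun (partEmb (partOf x)) (proj₁ nbr)
    fat-v : fat D v ≡ true
    fat-v = trans (fat-pres (partEmb (partOf x)) (proj₁ nbr)) (proj₁ (proj₂ nbr))
    xv = proj₂ (proj₂ nbr)
    yv : adj D (inD y) v ≡ true
    yv = let (b , fat-b , yb) = oneFat-nbr P y-in in
         subst (λ u → adj D (inD y) (fun (partEmb (partOf x)) u) ≡ true)
               (OneFatPart.fat-unique P b (proj₁ nbr) fat-b (proj₁ (proj₂ nbr))) yb
    common-one : commonFatG x y ≡ 1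
    common-one = count-singleton (commonFatNbr x y) v (∧-true fat-v (∧-true xv yv))
      (λ w s → oneFat-agree P (inPartOf x) (inPartOf x) w v (∧-trueˡ s) (∧-trueˡ (∧-trueʳ {fat D w} s)) fat-v xv)
    adjacent : adj G x y ≡ true
    adjacent with adj G x y in xy
    ... | true  = refl
    ... | false = ⊥-elim (contradictory (R⇒connected x y (∧-true (cong not (==-false x≢y))
                    (fatLink-intro D _ _ v (trans (inD-adj x y) xy) fat-v xv yv))) unconnected)

-- Its vertices are the vertices of G, the fat vertices
-- of D adjacent to G, and a fresh fat vertex for every unlinked vertex of G
-- lying in a part with one fat vertex.  Its parts are indexed by the
-- linking components; the part of the component of r consists of the
-- component, its fat neighbours in D and its fresh fat vertices.

module StrictHost (H : Family) (G : HoffmanGraph) (slimG : IsSlim G) (d : Cover (Hbar H) G) where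
  open CoverAnalysis H G slimG d public

  data Vertex : Set where
    gVertex : Fin (n G) → Vertex
    dVertex : Fin (n D) → Vertex
    fresh   : Fin (n G) → Vertex

  gVertex-injective : ∀ {x y} → gVertex x ≡ gVertex y → x ≡ y
  gVertex-injective refl = refl

  NV : ℕ
  NV = n G + (n D + n G)

  encode : Vertex → Fin NV
  encode (gVertex x) = x ↑ˡ (n D + n G)
  encode (dVertex v) = n G ↑ʳ (v ↑ˡ n G)
  encode (fresh y)   = n G ↑ʳ (n D ↑ʳ y)

  decodeTail : Fin (n D) ⊎ Fin (n G) → Vertex
  decodeTail (inj₁ v) = dVertex v
  decodeTail (inj₂ y) = fresh y

  decodeSplit : Fin (n G) ⊎ Fin (n D + n G) → Vertex
  decodeSplit (inj₁ x) = gVertex x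
  decodeSplit (inj₂ w) = decodeTail (splitAt (n D) w)

  decode : Fin NV → Vertex
  decode z = decodeSplit (splitAt (n G) z)

  decode-encode : ∀ c → decode (encode c) ≡ c
  decode-encode (gVertex x) rewrite splitAt-↑ˡ (n G) x (n D + n G) = refl
  decode-encode (dVertex v) rewrite splitAt-↑ʳ (n G) (n D + n G) (v ↑ˡ n G) | splitAt-↑ˡ (n D) v (n G) = refl
  decode-encode (fresh y)   rewrite splitAt-↑ʳ (n G) (n D + n G) (n D ↑ʳ y) | splitAt-↑ʳ (n D) (n G) y = refl

  encode-decode : ∀ z → encode (decode z) ≡ z
  encode-decode z = trans (encode-split (splitAt (n G) z)) (join-splitAt (n G) (n D + n G) z)
    where
    encode-tail : ∀ t → encode (decodeTail t) ≡ n G ↑ʳ join (n D) (n G) t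
    encode-tail (inj₁ v) = refl
    encode-tail (inj₂ y) = refl
    encode-split : ∀ s → encode (decodeSplit s) ≡ join (n G) (n D + n G) s
    encode-split (inj₁ x) = refl
    encode-split (inj₂ w) = trans (encode-tail (splitAt (n D) w)) (cong (n G ↑ʳ_) (join-splitAt (n D) (n G) w))

  count-Vertex : (φ : Vertex → Bool) → count (λ z → φ (decode z)) ≡
    count (λ x → φ (gVertex x)) + (count (λ v → φ (dVertex v)) + count (λ y → φ (fresh y)))
  count-Vertex φ = trans (count-+ (n G) (λ z → φ (decode z)))
    (cong₂ _+_ (count-ext _ _ (λ x → cong φ (decode-encode (gVertex x))))
      (trans (count-+ (n D) (λ w → φ (decode (n G ↑ʳ w))))
        (cong₂ _+_ (count-ext _ _ (λ v → cong φ (decode-encode (dVertex v))))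
                   (count-ext _ _ (λ y → cong φ (decode-encode (fresh y)))))))

  adjᶜ : Vertex → Vertex → Bool
  adjᶜ (gVertex x) (gVertex y) = adj G x y
  adjᶜ (gVertex x) (dVertex v) = adj D (inD x) v
  adjᶜ (gVertex x) (fresh y)   = x == y
  adjᶜ (dVertex v) (gVertex x) = adj D (inD x) v
  adjᶜ (dVertex v) (dVertex _) = false
  adjᶜ (dVertex v) (fresh _)   = false
  adjᶜ (fresh y)   (gVertex x) = x == y
  adjᶜ (fresh y)   (dVertex _) = false
  adjᶜ (fresh y)   (fresh _)   = false

  fatᶜ : Vertex → Bool
  fatᶜ (gVertex _) = false
  fatᶜ (dVertex v) = fat D v
  fatᶜ (fresh _)   = true

  adjᶜ-sym : ∀ c c' → adjᶜ c c' ≡ adjᶜ c' c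
  adjᶜ-sym (gVertex x) (gVertex y) = adj-sym G x y
  adjᶜ-sym (gVertex x) (dVertex v) = refl
  adjᶜ-sym (gVertex x) (fresh y)   = refl
  adjᶜ-sym (dVertex v) (gVertex x) = refl
  adjᶜ-sym (dVertex v) (dVertex _) = refl
  adjᶜ-sym (dVertex v) (fresh _)   = refl
  adjᶜ-sym (fresh y)   (gVertex x) = refl
  adjᶜ-sym (fresh y)   (dVertex _) = refl
  adjᶜ-sym (fresh y)   (fresh _)   = refl

  adjᶜ-irrefl : ∀ c → adjᶜ c c ≡ false
  adjᶜ-irrefl (gVertex x) = adj-irrefl G x
  adjᶜ-irrefl (dVertex v) = refl
  adjᶜ-irrefl (fresh y)   = refl

  -- only vertices of G have fat neighbours
  fatᶜ-indep : ∀ c c' → fatᶜ c ≡ true → fatᶜ c' ≡ true → adjᶜ c c' ≡ false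
  fatᶜ-indep (dVertex _) (dVertex _) _ _ = refl
  fatᶜ-indep (dVertex _) (fresh _)   _ _ = refl
  fatᶜ-indep (fresh _)   (dVertex _) _ _ = refl
  fatᶜ-indep (fresh _)   (fresh _)   _ _ = refl

  Big : PreHoffman
  Big = record
    { size = NV ; adjᵖ = λ z z' → adjᶜ (decode z) (decode z') ; fatᵖ = λ z → fatᶜ (decode z)
    ; adjᵖ-sym = λ z z' → adjᶜ-sym (decode z) (decode z') ; adjᵖ-irrefl = λ z → adjᶜ-irrefl (decode z)
    ; fatᵖ-indep = λ z z' → fatᶜ-indep (decode z) (decode z') }

  needsFresh : Fin (n G) → Bool
  needsFresh y = not (linked y) ∧ hasOneFat (kind (partOf y))

  fatNbrOf : (Fin (n G) → Bool) → Fin (n D) → Bool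
  fatNbrOf S v = fat D v ∧ anyFin (λ x → S x ∧ adj D (inD x) v)

  inHost : Vertex → Bool
  inHost (gVertex _) = true
  inHost (dVertex v) = fatNbrOf (λ _ → true) v
  inHost (fresh y)   = needsFresh y

  inComponent : Fin (n G) → Vertex → Bool
  inComponent r (gVertex x) = connected r x
  inComponent r (dVertex v) = fatNbrOf (connected r) v
  inComponent r (fresh y)   = connected r y ∧ needsFresh y

  inComponent⊆inHost : ∀ r c → inComponent r c ≡ true → inHost c ≡ true
  inComponent⊆inHost r (gVertex x) p = refl
  inComponent⊆inHost r (dVertex v) p =
    ∧-true (∧-trueˡ p) (anyFin-mono _ _ (λ x q → ∧-true {true} refl (∧-trueʳ {connected r x} q)) (∧-trueʳ {fat D v} p))
  inComponent⊆inHost r (fresh y)   p = ∧-trueʳ {connected r y} p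

  hasSlimNbrs : (S : Fin (n G) → Bool) (P : Vertex → Bool) →
    (∀ x → P (gVertex x) ≡ S x) → (∀ v → P (dVertex v) ≡ true → fatNbrOf S v ≡ true) →
    (∀ y → P (fresh y) ≡ true → S y ≡ true) → HasSlimNbrs Big (λ z → P (decode z))
  hasSlimNbrs S P P-g P-d P-fresh z Pz fat-z = slimNbr (decode z) (encode-decode z) Pz fat-z
    where
    asVertex : ∀ x → S x ≡ true → ∃[ w ] (P (decode w) ≡ true × decode w ≡ gVertex x)
    asVertex x p = encode (gVertex x) , subst (λ u → P u ≡ true) (sym (decode-encode (gVertex x))) (trans (P-g x) p)
                                      , decode-encode (gVertex x)
    slimNbr : ∀ c → encode c ≡ z → P c ≡ true → fatᶜ c ≡ true →
              ∃[ w ] (P (decode w) ≡ true × adjᶜ (decode z) (decode w) ≡ true × fatᶜ (decode w) ≡ false)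
    slimNbr (dVertex v) refl p _ =
      let (x , q) = anyFin-witness _ (∧-trueʳ {fat D v} (P-d v p)) ; (w , Pw , dw) = asVertex x (∧-trueˡ q) in
      w , Pw , subst₂ (λ a b → adjᶜ a b ≡ true) (sym (decode-encode (dVertex v))) (sym dw) (∧-trueʳ {S x} q)
        , subst (λ u → fatᶜ u ≡ false) (sym dw) refl
    slimNbr (fresh y) refl p _ =
      let (w , Pw , dw) = asVertex y (P-fresh y p) in
      w , Pw , subst₂ (λ a b → adjᶜ a b ≡ true) (sym (decode-encode (fresh y))) (sym dw) (==-refl y)
        , subst (λ u → fatᶜ u ≡ false) (sym dw) refl

  host-slimNbrs : HasSlimNbrs Big (λ z → inHost (decode z))
  host-slimNbrs = hasSlimNbrs (λ _ → true) inHost (λ _ → refl) (λ _ p → p) (λ _ _ → refl)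

  component-slimNbrs : ∀ r → HasSlimNbrs Big (λ z → inComponent r (decode z))
  component-slimNbrs r = hasSlimNbrs (connected r) (inComponent r) (λ _ → refl) (λ _ p → p) (λ y p → ∧-trueˡ p)

  Host : HoffmanGraph
  Host = Induced Big (λ z → inHost (decode z)) host-slimNbrs

  inHostᵇ : Fin NV → Bool
  inHostᵇ z = inHost (decode z)

  #components : ℕ
  #components = count isRep

  repOf : Fin #components → Fin (n G)
  repOf = nth isRep

  inPart : Fin #components → Fin NV → Bool
  inPart t z = inComponent (repOf t) (decode z)

  Part : Fin #components → HoffmanGraph
  Part t = Induced Big (inPart t) (component-slimNbrs (repOf t))

  partInHost : ∀ t → Part t ↪ Host
  partInHost t = Induced-⊆ Big (inPart t) inHostᵇ (component-slimNbrs (repOf t)) host-slimNbrs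
                           (λ z → inComponent⊆inHost (repOf t) (decode z))

  partInHost-nth : ∀ t q → nth inHostᵇ (fun (partInHost t) q) ≡ nth (inPart t) q
  partInHost-nth t q = nth-rank inHostᵇ _ _

  partInHost-at : ∀ t q h → nth (inPart t) q ≡ nth inHostᵇ h → fun (partInHost t) q ≡ h
  partInHost-at t q h e = trans (rank-cong inHostᵇ _ _ _ (nth-member inHostᵇ h) e) (rank-nth inHostᵇ h _)

  componentOf : Fin (n G) → Fin #components
  componentOf x = rank isRep (rep x) (isRep-rep x)

  in-componentOf : ∀ x → connected (repOf (componentOf x)) x ≡ true
  in-componentOf x = subst (λ u → connected u x ≡ true) (sym (nth-rank isRep (rep x) (isRep-rep x)))
                           (connected-sym x (rep x) (connected-rep x))

  component-unique : ∀ t t' x → connected (repOf t) x ≡ true → connected (repOf t') x ≡ true → t ≡ t'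
  component-unique t t' x p q = nth-injective isRep t t'
    (trans (isRep-unique (repOf t) x (nth-member isRep t) p) (sym (isRep-unique (repOf t') x (nth-member isRep t') q)))

  host-vertex-in-part : ∀ c → inHost c ≡ true → ∃[ t ] (inComponent (repOf t) c ≡ true)
  host-vertex-in-part (gVertex x) _ = componentOf x , in-componentOf x
  host-vertex-in-part (dVertex v) p =
    let (x , q) = anyFin-witness _ (∧-trueʳ {fat D v} p) in
    componentOf x , ∧-true (∧-trueˡ p) (anyFin-intro _ x (∧-true (in-componentOf x) (∧-trueʳ {true} q)))
  host-vertex-in-part (fresh y)   p = componentOf y , ∧-true (in-componentOf y) p

  slim-in-component : ∀ r c → fatᶜ c ≡ false → inComponent r c ≡ true →
                      ∃[ x ] (c ≡ gVertex x × connected r x ≡ true)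
  slim-in-component r (gVertex x) _ p = x , refl , p
  slim-in-component r (dVertex v) slim p = ⊥-elim (contradictory (∧-trueˡ p) slim)

  slim-of-part : ∀ t q → fat (Part t) q ≡ false →
                 ∃[ x ] (decode (nth (inPart t) q) ≡ gVertex x × connected (repOf t) x ≡ true)
  slim-of-part t q slim = slim-in-component (repOf t) (decode (nth (inPart t) q)) slim (nth-member (inPart t) q)

  fatNbr-in-component : ∀ r x c → connected r x ≡ true → fatᶜ c ≡ true → adjᶜ (gVertex x) c ≡ true →
                        inHost c ≡ true → inComponent r c ≡ true
  fatNbr-in-component r x (dVertex v) rx fat-v xv _ = ∧-true fat-v (anyFin-intro _ x (∧-true rx xv))
  fatNbr-in-component r x (fresh y)   rx _     xy k with ==-sound x y xy
  ... | refl = ∧-true rx k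

  -- distinct vertices of G have the same common fat neighbours in the host as
  -- in D: the kept D-vertices are exactly the fat neighbours of G, and a
  -- fresh vertex has a single neighbour
  commonFat-host : ∀ h h' x y → decode (nth inHostᵇ h) ≡ gVertex x → decode (nth inHostᵇ h') ≡ gVertex y →
                   x ≢ y → commonFat Host h h' ≡ commonFatG x y
  commonFat-host h h' x y eh eh' x≢y = begin
    commonFat Host h h'
      ≡⟨ count-∘nth inHostᵇ (λ z → fatᶜ (decode z) ∧ (adjᶜ (decode (nth inHostᵇ h)) (decode z)
                                                     ∧ adjᶜ (decode (nth inHostᵇ h')) (decode z))) ⟩
    count sharedInHost
      ≡⟨ count-ext _ _ (λ z → cong₂ (λ a b → inHostᵇ z ∧ (fatᶜ (decode z) ∧ (adjᶜ a (decode z) ∧ adjᶜ b (decode z))))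
                                     eh eh') ⟩
    count (λ z → shared (decode z))
      ≡⟨ count-Vertex shared ⟩
    count (λ x' → shared (gVertex x')) + (count (λ v → shared (dVertex v)) + count (λ y' → shared (fresh y')))
      ≡⟨ cong₂ _+_ (count-none (λ x' → shared (gVertex x')) (λ _ → refl)) (cong₂ _+_ D-block (count-none _ fresh-block)) ⟩
    commonFatG x y + 0
      ≡⟨ +-identityʳ _ ⟩
    commonFatG x y ∎
    where
    open ≡-Reasoning
    sharedInHost : Fin NV → Bool
    sharedInHost z = inHostᵇ z ∧ (fatᶜ (decode z) ∧ (adjᶜ (decode (nth inHostᵇ h)) (decode z)
                                                    ∧ adjᶜ (decode (nth inHostᵇ h')) (decode z)))
    shared : Vertex → Bool
    shared c = inHost c ∧ (fatᶜ c ∧ (adjᶜ (gVertex x) c ∧ adjᶜ (gVertex y) c))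
    D-block : count (λ v → shared (dVertex v)) ≡ commonFatG x y
    D-block = count-ext _ _ (λ v → ∧-absorbˡ (inHost (dVertex v)) (commonFatNbr x y v)
      (λ s → ∧-true {fat D v} (∧-trueˡ s) (anyFin-intro _ x (∧-true {true} refl (∧-trueˡ (∧-trueʳ {fat D v} s))))))
    fresh-block : ∀ w → shared (fresh w) ≡ false
    fresh-block w = ¬-not (λ s → x≢y (trans (==-sound x w (∧-trueˡ (∧-trueʳ {needsFresh w} s)))
                                             (sym (==-sound y w (∧-trueʳ (∧-trueʳ {needsFresh w} s))))))

  slim-in-host : ∀ t q → fat (Part t) q ≡ false →
                 ∃[ x ] (decode (nth inHostᵇ (fun (partInHost t) q)) ≡ gVertex x × connected (repOf t) x ≡ true)
  slim-in-host t q slim = let (x , dx , rx) = slim-of-part t q slim in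
                          x , trans (cong decode (partInHost-nth t q)) dx , rx

  parts-cover : ∀ h → ∃[ t ] ∃[ q ] (fun (partInHost t) q ≡ h)
  parts-cover h =
    let (t , p) = host-vertex-in-part (decode (nth inHostᵇ h)) (nth-member inHostᵇ h) in
    t , rank (inPart t) (nth inHostᵇ h) p , partInHost-at t _ h (nth-rank (inPart t) (nth inHostᵇ h) p)

  parts-slim-disjoint : ∀ t t' q q' → fat (Part t) q ≡ false → fun (partInHost t) q ≡ fun (partInHost t') q' → t ≡ t'
  parts-slim-disjoint t t' q q' slim e =
    let same = trans (sym (partInHost-nth t q)) (trans (cong (nth inHostᵇ) e) (partInHost-nth t' q'))
        (x , dx , rx) = slim-of-part t q slim
        rx' = subst (λ u → inComponent (repOf t') u ≡ true) (trans (cong decode (sym same)) dx)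
                    (nth-member (inPart t') q')
    in component-unique t t' x rx rx'

  parts-fat-nbrs : ∀ t q h → fat (Part t) q ≡ false → fat Host h ≡ true →
                   adj Host (fun (partInHost t) q) h ≡ true → ∃[ q' ] (fun (partInHost t) q' ≡ h)
  parts-fat-nbrs t q h slim fat-h adjacent =
    let (x , dx , rx) = slim-in-host t q slim
        xh = subst (λ u → adjᶜ u (decode (nth inHostᵇ h)) ≡ true) dx adjacent
        in-part = fatNbr-in-component (repOf t) x (decode (nth inHostᵇ h)) rx fat-h xh (nth-member inHostᵇ h)
    in rank (inPart t) (nth inHostᵇ h) in-part , partInHost-at t _ h (nth-rank (inPart t) (nth inHostᵇ h) in-part)

  -- slim vertices of different parts are distinct, unconnected vertices of G
  parts-sumCondition : ∀ t t' q q' → t ≢ t' → fat (Part t) q ≡ false → fat (Part t') q' ≡ false →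
    let u = fun (partInHost t) q ; u' = fun (partInHost t') q' in
    (commonFat Host u u' ≤ 1) × (commonFat Host u u' ≡ 1 → adj Host u u' ≡ true)
                              × (adj Host u u' ≡ true → commonFat Host u u' ≡ 1)
  parts-sumCondition t t' q q' t≢t' slim slim' =
    subst (_≤ 1) (sym common≡) le , (λ c → trans adj≡ (one⇒adj (trans (sym common≡) c)))
                                  , (λ a → trans common≡ (adj⇒one (trans (sym adj≡) a)))
    where
    located = slim-in-host t q slim
    located' = slim-in-host t' q' slim'
    x = proj₁ located
    y = proj₁ located'
    rx = proj₂ (proj₂ located)
    ry = proj₂ (proj₂ located')
    x≢y : x ≢ y
    x≢y x≡y = t≢t' (component-unique t t' y (subst (λ u → connected (repOf t) u ≡ true) x≡y rx) ry)
    unconnected : connected x y ≡ false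
    unconnected = ¬-not (λ c → t≢t' (component-unique t t' y (connected-trans (repOf t) x y rx c) ry))
    condition = unconnected-sumCondition x y x≢y unconnected
    le = proj₁ condition
    one⇒adj = proj₁ (proj₂ condition)
    adj⇒one = proj₂ (proj₂ condition)
    common≡ = commonFat-host _ _ x y (proj₁ (proj₂ located)) (proj₁ (proj₂ located')) x≢y
    adj≡ : adj Host (fun (partInHost t) q) (fun (partInHost t') q') ≡ adj G x y
    adj≡ = cong₂ adjᶜ (proj₁ (proj₂ located)) (proj₁ (proj₂ located'))

  host-isSum : IsSum Host Part partInHost
  host-isSum = record
    { covers    = parts-cover
    ; slim-disj = λ t t' q q' slim e → parts-slim-disjoint t t' q q' slim e
    ; fat-nbrs  = parts-fat-nbrs
    ; common-le = λ t t' q q' ne s s' → proj₁ (parts-sumCondition t t' q q' ne s s')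
    ; common-eq = λ t t' q q' ne s s' → proj₂ (parts-sumCondition t t' q q' ne s s') }

  G-in-host : G ↪ Host
  G-in-host = record
    { fun       = vertexOf
    ; injective = λ x y e → gVertex-injective
        (trans (sym (decode-encode (gVertex x)))
          (trans (cong decode (trans (sym (nth-vertexOf x)) (trans (cong (nth inHostᵇ) e) (nth-vertexOf y))))
                 (decode-encode (gVertex y))))
    ; adj-pres  = λ x y → trans (cong₂ (λ a b → adjᶜ (decode a) (decode b)) (nth-vertexOf x) (nth-vertexOf y))
                                (cong₂ adjᶜ (decode-encode (gVertex x)) (decode-encode (gVertex y)))
    ; fat-pres  = λ x → trans (cong (λ a → fatᶜ (decode a)) (nth-vertexOf x))
                              (trans (cong fatᶜ (decode-encode (gVertex x))) (sym (slimG x))) }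
    where
    kept : ∀ x → inHostᵇ (encode (gVertex x)) ≡ true
    kept x = cong inHost (decode-encode (gVertex x))
    vertexOf : Fin (n G) → Fin (n Host)
    vertexOf x = rank inHostᵇ (encode (gVertex x)) (kept x)
    nth-vertexOf : ∀ x → nth inHostᵇ (vertexOf x) ≡ encode (gVertex x)
    nth-vertexOf x = nth-rank inHostᵇ _ (kept x)

  host-strict : ∀ h → fat Host h ≡ false → ∃[ x ] (fun G-in-host x ≡ h)
  host-strict h slim =
    let (x , dx) = slim-kept (decode (nth inHostᵇ h)) slim (nth-member inHostᵇ h)
        encoded : encode (gVertex x) ≡ nth inHostᵇ h
        encoded = trans (cong encode (sym dx)) (encode-decode (nth inHostᵇ h))
    in x , trans (rank-cong inHostᵇ _ _ _ (nth-member inHostᵇ h) encoded) (rank-nth inHostᵇ h _)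
    where
    slim-kept : ∀ c → fatᶜ c ≡ false → inHost c ≡ true → ∃[ x ] (c ≡ gVertex x)
    slim-kept (gVertex x) _ _ = x , refl
    slim-kept (dVertex v) slim k = ⊥-elim (contradictory (∧-trueˡ k) slim)

  strictCover : ∀ {F} → (∀ t → Part t ∈̂ F) → StrictCover F G
  strictCover parts∈F = record
    { cover  = record { host  = Host
                      ; sum   = record { k = #components ; part = Part ; emb = partInHost
                                       ; inF = parts∈F ; isSum = host-isSum }
                      ; embed = G-in-host }
    ; strict = host-strict }

  module ComponentPart (t : Fin #components) where
    r : Fin (n G)
    r = repOf t

    codeOf : Fin (n (Part t)) → Vertex
    codeOf q = decode (nth (inPart t) q)

    codeOf-member : ∀ q → inComponent r (codeOf q) ≡ true
    codeOf-member = nth-member (inPart t)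

    vertex : ∀ c → inComponent r c ≡ true → Fin (n (Part t))
    vertex c p = rank (inPart t) (encode c) (trans (cong (inComponent r) (decode-encode c)) p)

    codeOf-vertex : ∀ c p → codeOf (vertex c p) ≡ c
    codeOf-vertex c p = trans (cong decode (nth-rank (inPart t) (encode c) _)) (decode-encode c)

    vertex-codeOf : ∀ q c p → codeOf q ≡ c → q ≡ vertex c p
    vertex-codeOf q c p e = trans (sym (rank-nth (inPart t) q (nth-member (inPart t) q)))
      (rank-cong (inPart t) _ _ _ _ (trans (sym (encode-decode (nth (inPart t) q))) (cong encode e)))

    adj-vertex : ∀ c p c' p' → adj (Part t) (vertex c p) (vertex c' p') ≡ adjᶜ c c'
    adj-vertex c p c' p' = cong₂ adjᶜ (codeOf-vertex c p) (codeOf-vertex c' p')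

    fat-vertex : ∀ c p → fat (Part t) (vertex c p) ≡ fatᶜ c
    fat-vertex c p = cong fatᶜ (codeOf-vertex c p)

    vertex-injective : ∀ c p c' p' → vertex c p ≡ vertex c' p' → c ≡ c'
    vertex-injective c p c' p' e = trans (sym (codeOf-vertex c p)) (trans (cong codeOf e) (codeOf-vertex c' p'))

    module TwoFatNbrs (c₁ c₂ : Vertex) (c₁≢c₂ : c₁ ≢ c₂) (fat₁ : fatᶜ c₁ ≡ true) (fat₂ : fatᶜ c₂ ≡ true)
                      (adj₁ : adjᶜ (gVertex r) c₁ ≡ true) (adj₂ : adjᶜ (gVertex r) c₂ ≡ true)
                      (in₁ : inComponent r c₁ ≡ true) (in₂ : inComponent r c₂ ≡ true)
                      (only : ∀ c → inComponent r c ≡ true → (c ≡ gVertex r) ⊎ (c ≡ c₁) ⊎ (c ≡ c₂)) where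
      code : Fin 3 → Vertex
      code zero             = gVertex r
      code (suc zero)       = c₁
      code (suc (suc zero)) = c₂

      member : ∀ y → inComponent r (code y) ≡ true
      member zero             = connected-refl r
      member (suc zero)       = in₁
      member (suc (suc zero)) = in₂

      slim≢fat : ∀ {c} → fatᶜ c ≡ true → gVertex r ≢ c
      slim≢fat fat-c e = contradictory (subst (λ c → fatᶜ c ≡ true) (sym e) fat-c) refl

      code-injective : ∀ y y' → code y ≡ code y' → y ≡ y'
      code-injective zero             zero             _ = refl
      code-injective zero             (suc zero)       e = ⊥-elim (slim≢fat fat₁ e)
      code-injective zero             (suc (suc zero)) e = ⊥-elim (slim≢fat fat₂ e)
      code-injective (suc zero)       zero             e = ⊥-elim (slim≢fat fat₁ (sym e))
      code-injective (suc zero)       (suc zero)       _ = refl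
      code-injective (suc zero)       (suc (suc zero)) e = ⊥-elim (c₁≢c₂ e)
      code-injective (suc (suc zero)) zero             e = ⊥-elim (slim≢fat fat₂ (sym e))
      code-injective (suc (suc zero)) (suc zero)       e = ⊥-elim (c₁≢c₂ (sym e))
      code-injective (suc (suc zero)) (suc (suc zero)) _ = refl

      code-adj : ∀ y y' → adjᶜ (code y) (code y') ≡ adj 𝔥₂ y y'
      code-adj zero             zero             = adj-irrefl G r
      code-adj zero             (suc zero)       = adj₁
      code-adj zero             (suc (suc zero)) = adj₂
      code-adj (suc zero)       zero             = trans (adjᶜ-sym c₁ (gVertex r)) adj₁
      code-adj (suc zero)       (suc zero)       = adjᶜ-irrefl c₁
      code-adj (suc zero)       (suc (suc zero)) = fatᶜ-indep c₁ c₂ fat₁ fat₂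
      code-adj (suc (suc zero)) zero             = trans (adjᶜ-sym c₂ (gVertex r)) adj₂
      code-adj (suc (suc zero)) (suc zero)       = fatᶜ-indep c₂ c₁ fat₂ fat₁
      code-adj (suc (suc zero)) (suc (suc zero)) = adjᶜ-irrefl c₂

      code-fat : ∀ y → fatᶜ (code y) ≡ fat 𝔥₂ y
      code-fat zero             = refl
      code-fat (suc zero)       = fat₁
      code-fat (suc (suc zero)) = fat₂

      code-hits : ∀ c → inComponent r c ≡ true → ∃[ y ] (code y ≡ c)
      code-hits c p with only c p
      ... | inj₁ e        = zero , sym e
      ... | inj₂ (inj₁ e) = suc zero , sym e
      ... | inj₂ (inj₂ e) = suc (suc zero) , sym e

      part≅𝔥₂ : Part t ≅ 𝔥₂
      part≅𝔥₂ = ≅-sym (record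
        { emb = record
          { fun       = λ y → vertex (code y) (member y)
          ; injective = λ y y' e → code-injective y y' (vertex-injective (code y) (member y) (code y') (member y') e)
          ; adj-pres  = λ y y' → trans (adj-vertex (code y) (member y) (code y') (member y')) (code-adj y y')
          ; fat-pres  = λ y → trans (fat-vertex (code y) (member y)) (code-fat y) }
        ; surjective = λ q → let (y , e) = code-hits (codeOf q) (codeOf-member q) in
                             y , sym (vertex-codeOf q (code y) (member y) (sym e)) })

    unlinked-part-vertices : linked r ≡ false → ∀ c → inComponent r c ≡ true →
      (c ≡ gVertex r) ⊎ (∃[ v ] (c ≡ dVertex v × fat D v ≡ true × adj D (inD r) v ≡ true))
                      ⊎ (c ≡ fresh r × needsFresh r ≡ true)
    unlinked-part-vertices unlinked (gVertex x) p with unlinked-component r x unlinked p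
    ... | refl = inj₁ refl
    unlinked-part-vertices unlinked (dVertex v) p
      with anyFin-witness (λ x → connected r x ∧ adj D (inD x) v) (∧-trueʳ {fat D v} p)
    ... | x , q with unlinked-component r x unlinked (∧-trueˡ q)
    ...   | refl = inj₂ (inj₁ (v , refl , ∧-trueˡ p , ∧-trueʳ {connected r r} q))
    unlinked-part-vertices unlinked (fresh y) p with unlinked-component r y unlinked (∧-trueˡ p)
    ... | refl = inj₂ (inj₂ (refl , ∧-trueʳ {connected r r} p))

    fatNbr-member : ∀ x v → connected r x ≡ true → fat D v ≡ true → adj D (inD x) v ≡ true →
                    inComponent r (dVertex v) ≡ true
    fatNbr-member x v rx fat-v xv = ∧-true fat-v (anyFin-intro _ x (∧-true rx xv))

    module UnlinkedIn𝔥₂ (unlinked : linked r ≡ false) (c : part (partOf r) ≅ 𝔥₂) (no-fresh : needsFresh r ≡ false) where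
      i = partOf r
      φ = fun (emb c)

      one two : Fin 3
      one = suc zero
      two = suc (suc zero)

      ψ : Fin 3 → Fin (n (part i))
      ψ y = proj₁ (surjective c y)

      φψ : ∀ y → φ (ψ y) ≡ y
      φψ y = proj₂ (surjective c y)

      F : Fin 3 → Fin (n D)
      F y = fun (partEmb i) (ψ y)

      r' = proj₁ (inPartOf r)

      φr' : φ r' ≡ zero
      φr' = 𝔥₂-slim-zero _ (trans (fat-pres (emb c) r') (InPart-slim (inPartOf r)))

      fat-F : ∀ y → fat 𝔥₂ y ≡ true → fat D (F y) ≡ true
      fat-F y f = trans (fat-pres (partEmb i) (ψ y)) (trans (sym (fat-pres (emb c) (ψ y))) (trans (cong (fat 𝔥₂) (φψ y)) f))

      adj-F : ∀ y → adj 𝔥₂ zero y ≡ true → adj D (inD r) (F y) ≡ true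
      adj-F y a = trans (cong (λ u → adj D u (F y)) (sym (proj₂ (inPartOf r))))
                    (trans (adj-pres (partEmb i) r' (ψ y))
                      (trans (sym (adj-pres (emb c) r' (ψ y))) (trans (cong₂ (adj 𝔥₂) φr' (φψ y)) a)))

      F₁≢F₂ : dVertex (F one) ≢ dVertex (F two)
      F₁≢F₂ e with trans (sym (φψ one)) (trans (cong φ (injective (partEmb i) _ _ (dVertex-injective e))) (φψ two))
        where dVertex-injective : ∀ {v w} → dVertex v ≡ dVertex w → v ≡ w
              dVertex-injective refl = refl
      ... | ()

      fatNbr-is-F : ∀ v → fat D v ≡ true → adj D (inD r) v ≡ true → (v ≡ F one) ⊎ (v ≡ F two)
      fatNbr-is-F v fat-v rv with fatNbr-in-part (inPartOf r) v fat-v rv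
      ... | a , ea , fat-a with φ a in e
      ...   | zero           = ⊥-elim (contradictory (trans (sym (cong (fat 𝔥₂) e)) (trans (fat-pres (emb c) a) fat-a)) refl)
      ...   | suc zero       = inj₁ (trans (sym ea) (cong (fun (partEmb i)) (injective (emb c) _ _ (trans e (sym (φψ one))))))
      ...   | suc (suc zero) = inj₂ (trans (sym ea) (cong (fun (partEmb i)) (injective (emb c) _ _ (trans e (sym (φψ two))))))

      only : ∀ c' → inComponent r c' ≡ true → (c' ≡ gVertex r) ⊎ (c' ≡ dVertex (F one)) ⊎ (c' ≡ dVertex (F two))
      only c' p with unlinked-part-vertices unlinked c' p
      ... | inj₁ e = inj₁ e
      ... | inj₂ (inj₂ (_ , needs)) = ⊥-elim (contradictory needs no-fresh)
      ... | inj₂ (inj₁ (v , refl , fat-v , rv)) with fatNbr-is-F v fat-v rv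
      ...   | inj₁ e = inj₂ (inj₁ (cong dVertex e))
      ...   | inj₂ e = inj₂ (inj₂ (cong dVertex e))

      part≅𝔥₂ : Part t ≅ 𝔥₂
      part≅𝔥₂ = TwoFatNbrs.part≅𝔥₂ (dVertex (F one)) (dVertex (F two)) F₁≢F₂ (fat-F one refl) (fat-F two refl)
        (adj-F one refl) (adj-F two refl)
        (fatNbr-member r (F one) (connected-refl r) (fat-F one refl) (adj-F one refl))
        (fatNbr-member r (F two) (connected-refl r) (fat-F two refl) (adj-F two refl)) only

    unlinked-in-oneFat : linked r ≡ false → OneFatPart H (part (partOf r)) → needsFresh r ≡ true → Part t ≅ 𝔥₂
    unlinked-in-oneFat unlinked P needs =
      TwoFatNbrs.part≅𝔥₂ (dVertex F) (fresh r) (λ ()) fat-F refl rF (==-refl r)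
        (fatNbr-member r F (connected-refl r) fat-F rF) (∧-true (connected-refl r) needs) only
      where
      i = partOf r
      nbr = oneFat-nbr P (inPartOf r)
      F : Fin (n D)
      F = fun (partEmb i) (proj₁ nbr)
      fat-F : fat D F ≡ true
      fat-F = trans (fat-pres (partEmb i) (proj₁ nbr)) (proj₁ (proj₂ nbr))
      rF = proj₂ (proj₂ nbr)
      only : ∀ c → inComponent r c ≡ true → (c ≡ gVertex r) ⊎ (c ≡ dVertex F) ⊎ (c ≡ fresh r)
      only c p with unlinked-part-vertices unlinked c p
      ... | inj₁ e = inj₁ e
      ... | inj₂ (inj₁ (v , e , fat-v , rv)) =
        inj₂ (inj₁ (trans e (cong dVertex (oneFat-agree P (inPartOf r) (inPartOf r) v F fat-v rv fat-F rF))))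
      ... | inj₂ (inj₂ (e , _)) = inj₂ (inj₂ e)

    unlinked-part≅𝔥₂ : linked r ≡ false → Part t ≅ 𝔥₂
    unlinked-part≅𝔥₂ unlinked with kind (partOf r) in kind-r
    ... | copy-of-𝔥₂ c = UnlinkedIn𝔥₂.part≅𝔥₂ unlinked c (needs kind-r)
      where needs : kind (partOf r) ≡ copy-of-𝔥₂ c → needsFresh r ≡ false
            needs e = trans (cong (λ k → not (linked r) ∧ hasOneFat k) e) (∧-zeroʳ (not (linked r)))
    ... | one-fat P = unlinked-in-oneFat unlinked P (needs kind-r)
      where needs : kind (partOf r) ≡ one-fat P → needsFresh r ≡ true
            needs e = cong₂ (λ a k → not a ∧ hasOneFat k) unlinked e

    module LinkedComponent (linked-r : linked r ≡ true) where
      i : Fin K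
      i = partOf r

      no-fresh : ∀ y → inComponent r (fresh y) ≡ false
      no-fresh y = ¬-not (λ p → contradictory (∧-trueʳ {connected r y} p)
        (cong (λ a → not a ∧ hasOneFat (kind (partOf y))) (linked-component r y linked-r (∧-trueˡ p))))

      inDᶜ : Vertex → Fin (n D)
      inDᶜ (gVertex x) = inD x
      inDᶜ (dVertex v) = v
      inDᶜ (fresh y)   = inD y

      inDᶜ-injective : ∀ c c' → inComponent r c ≡ true → inComponent r c' ≡ true → inDᶜ c ≡ inDᶜ c' → c ≡ c'
      inDᶜ-injective (gVertex x) (gVertex y) _ _  e = cong gVertex (inD-injective x y e)
      inDᶜ-injective (gVertex x) (dVertex v) _ p' e = ⊥-elim (contradictory (∧-trueˡ p') (trans (cong (fat D) (sym e)) (inD-slim x)))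
      inDᶜ-injective (dVertex v) (gVertex x) p _  e = ⊥-elim (contradictory (∧-trueˡ p) (trans (cong (fat D) e) (inD-slim x)))
      inDᶜ-injective (dVertex v) (dVertex w) _ _  e = cong dVertex e
      inDᶜ-injective c           (fresh y)   _ p' _ = ⊥-elim (contradictory p' (no-fresh y))
      inDᶜ-injective (fresh y)   c'          p _  _ = ⊥-elim (contradictory p (no-fresh y))

      inDᶜ-adj : ∀ c c' → inComponent r c ≡ true → inComponent r c' ≡ true → adj D (inDᶜ c) (inDᶜ c') ≡ adjᶜ c c'
      inDᶜ-adj (gVertex x) (gVertex y) _ _  = inD-adj x y
      inDᶜ-adj (gVertex x) (dVertex v) _ _  = refl
      inDᶜ-adj (dVertex v) (gVertex x) _ _  = adj-sym D v (inD x)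
      inDᶜ-adj (dVertex v) (dVertex w) p p' = fat-indep D v w (∧-trueˡ p) (∧-trueˡ p')
      inDᶜ-adj c           (fresh y)   _ p' = ⊥-elim (contradictory p' (no-fresh y))
      inDᶜ-adj (fresh y)   c'          p _  = ⊥-elim (contradictory p (no-fresh y))

      inDᶜ-fat : ∀ c → inComponent r c ≡ true → fat D (inDᶜ c) ≡ fatᶜ c
      inDᶜ-fat (gVertex x) _ = inD-slim x
      inDᶜ-fat (dVertex v) _ = refl
      inDᶜ-fat (fresh y)   p = ⊥-elim (contradictory p (no-fresh y))

      Part-in-D : Part t ↪ D
      Part-in-D = record
        { fun       = λ q → inDᶜ (codeOf q)
        ; injective = λ q q' e → nth-injective (inPart t) q q'
            (trans (sym (encode-decode _)) (trans (cong encode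
              (inDᶜ-injective (codeOf q) (codeOf q') (codeOf-member q) (codeOf-member q') e)) (encode-decode _)))
        ; adj-pres  = λ q q' → inDᶜ-adj (codeOf q) (codeOf q') (codeOf-member q) (codeOf-member q')
        ; fat-pres  = λ q → inDᶜ-fat (codeOf q) (codeOf-member q) }

      in-part-i : ∀ c → inComponent r c ≡ true → ∃[ a ] (fun (partEmb i) a ≡ inDᶜ c)
      in-part-i (gVertex x) p = component-part r x p
      in-part-i (dVertex v) p =
        let (x , q) = anyFin-witness _ (∧-trueʳ {fat D v} p)
            (a , ea , _) = fatNbr-in-part (component-part r x (∧-trueˡ q)) v (∧-trueˡ p) (∧-trueʳ {connected r x} q)
        in a , ea
      in-part-i (fresh y)   p = ⊥-elim (contradictory p (no-fresh y))

      Part↪part : Part t ↪ part i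
      Part↪part = ↪-factor Part-in-D (partEmb i) (λ q → in-part-i (codeOf q) (codeOf-member q))

      oneFat-i : OneFatPart H (part i)
      oneFat-i = component-oneFat r linked-r

      rVertex : Fin (n (Part t))
      rVertex = vertex (gVertex r) (connected-refl r)

      Part-isFat : IsFat (Part t)
      Part-isFat q slim =
        let (x , cx , rx) = slim-of-part t q slim
            (v , fat-v , xv) = linked-fatNbr x (linked-component r x linked-r rx)
            pv = fatNbr-member x v rx fat-v xv
        in vertex (dVertex v) pv , trans (fat-vertex (dVertex v) pv) fat-v
         , trans (cong₂ adjᶜ cx (codeOf-vertex (dVertex v) pv)) xv

      -- r and a vertex linked to it are two slim vertices
      Part-two-slim : 2 ≤ slimCount (Part t)
      Part-two-slim =
        let (y , l) = anyFin-witness (link r) linked-r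
            ry = R⇒connected r y l
        in count-two (λ q → not (fat (Part t) q)) rVertex (vertex (gVertex y) ry)
             (cong not (fat-vertex (gVertex r) (connected-refl r))) (cong not (fat-vertex (gVertex y) ry))
             (λ e → link-distinct r y l (gVertex-injective (vertex-injective (gVertex r) (connected-refl r) (gVertex y) ry e)))

      -- the part has a fat vertex and embeds in the part i, which has only one
      Part-fatCount-one : fatCount (Part t) ≡ 1
      Part-fatCount-one =
        let (q , slim-q , _) = Part-isFat rVertex (fat-vertex (gVertex r) (connected-refl r))
        in ≤-antisym (≤-trans (fatCount-↪ Part↪part) (≤-reflexive (OneFatPart.fatCount-one oneFat-i)))
                     (count-pos (fat (Part t)) q slim-q)

      -- links between vertices of G are fat-links in the part, so the slim
      -- vertices of the part are fat-link connected
      module PartLinks = Components (n (Part t)) (fatLink (Part t)) (fatLink-sym (Part t))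

      ReachedFromR : Fin (n G) → Set
      ReachedFromR z = ∃[ rz ] (PartLinks.connected rVertex (vertex (gVertex z) rz) ≡ true)

      link-step : ∀ z y → ReachedFromR z → link z y ≡ true → ReachedFromR y
      link-step z y (rz , conn) l =
        ry , PartLinks.connected-step rVertex (vertex (gVertex z) rz) (vertex (gVertex y) ry) conn
               (fatLink-intro (Part t) _ _ (vertex (dVertex v) pv)
                 (trans (adj-vertex (gVertex z) rz (gVertex y) ry) (link-nonadjacent z y l))
                 (trans (fat-vertex (dVertex v) pv) fat-v)
                 (trans (adj-vertex (gVertex z) rz (dVertex v) pv) zv)
                 (trans (adj-vertex (gVertex y) ry (dVertex v) pv) yv))
        where
        ry = connected-step r z y rz l
        shared = link-shareFat z y l
        v = proj₁ shared
        fat-v = proj₁ (proj₂ shared)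
        zv = proj₁ (proj₂ (proj₂ shared))
        yv = proj₂ (proj₂ (proj₂ shared))
        pv = fatNbr-member z v rz fat-v zv

      slim-reached : ∀ q → fat (Part t) q ≡ false → PartLinks.connected rVertex q ≡ true
      slim-reached q slim =
        let (x , cx , rx) = slim-of-part t q slim
            (rx' , conn) = connected-induction ReachedFromR link-step r x (connected-refl r , PartLinks.connected-refl rVertex) rx
        in subst (λ u → PartLinks.connected rVertex u ≡ true)
                 (sym (vertex-codeOf q (gVertex x) rx' cx)) conn

      Part-indecomposable : Indecomposable (Part t)
      Part-indecomposable = fatLinked-indecomposable (Part t) λ q q' slim slim' →
        PartLinks.connected-trans q rVertex q' (PartLinks.connected-sym rVertex q (slim-reached q slim))
                                              (slim-reached q' slim')

      Part-in-Hbar : Hbar H (Part t)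
      Part-in-Hbar =
        let (h , H-h , i↪h) = OneFatPart.inside-H oneFat-i in
        inj₂ (inj₂ (Part-indecomposable , Part-isFat , Part-two-slim , Part-fatCount-one) , h , H-h , ↪-trans Part↪part i↪h)

-- Every slim ℋ(m)-line graph has a strict ℋ(m)-cover: the parts of the
-- strict host are copies of 𝔥₂ or Hoffman subgraphs of the original parts
-- with the same single fat vertex, which come no later in the enumeration.

strict-truncated-cover : ∀ H (E : Enumeration (Hbar H)) G → IsSlim G →
                         ∀ m → Cover (truncate E m) G → StrictCover (truncate E m) G
strict-truncated-cover H E G slimG m d = strictCover Part∈truncate
  where
  open Truncation H E
  open StrictHost H G slimG (Cover-map (truncate⊆Hbar m) d)
  Part∈truncate : ∀ t → Part t ∈̂ truncate E m
  Part∈truncate t with linked (repOf t) in linked?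
  ... | false = 𝔥₂∈truncate m (Part t) (ComponentPart.unlinked-part≅𝔥₂ t linked?)
  ... | true  = truncate-↪-closed m (Part t) (part i) Part↪part
                  (trans Part-fatCount-one (sym (OneFatPart.fatCount-one oneFat-i)))
                  Part-in-Hbar (FSum.inF (sum d) i)
    where open ComponentPart.LinkedComponent t linked?

lemma3p15 : (H : Family) → (∀ h → H h → 𝒪 h) → 𝔥₂ ∈̂ H →
    (E : Enumeration (Hbar H)) →
    (G : HoffmanGraph) → IsSlim G → IsLineGraph H G →
    (UniqueStrictCover (Hbar H) G →
       ((m : ℕ) → IsLineGraph (truncate E m) G → UniqueStrictCover (truncate E m) G))
    × (((m : ℕ) → IsLineGraph (truncate E m) G → UniqueStrictCover (truncate E m) G) →
       UniqueStrictCover (Hbar H) G)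
lemma3p15 H H⊆𝒪 _ E G slimG H-line =
  (λ unique m d → unique-restricts m G (strict-truncated-cover H E G slimG m d) unique) ,
  unique-extends H⊆𝒪 G H-line
  where open Truncation H E
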